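{- Let $p$ be a prime, $n\ge 1$, $G$ the elementary abelian group of order $p^n$, and $\mathcal{A}$ a $p$-$S$-ring over $G$ with $|G:O_\theta(\mathcal{A})|=p$. Then: (1) there is an $\mathcal{A}$-subgroup $L\le O_\theta(\mathcal{A})$ such that $\mathcal{A}$ is the $O_\theta(\mathcal{A})/L$-wreath product with $\mathcal{A}_{O_\theta(\mathcal{A})}=\mathbb{Z}O_\theta(\mathcal{A})$ and $\mathcal{A}_{G/L}=\mathbb{Z}(G/L)$; (2) $\mathcal{A}$ is a cyclotomic, Cayley minimal $CI$-$S$-ring.
   Context: An $S$-ring over a finite group $G$ (identity $e$) is a subring $\mathcal{A}\subseteq\mathbb{Z}G$ spanned over $\mathbb{Z}$ by the elements $\underline{X}=\sum_{x\in X}x$ for $X$ in a partition $\mathcal{S}(\mathcal{A})$ of $G$ (basic sets) with $\{e\}\in\mathcal{S}(\mathcal{A})$ and closed under $X\mapsto X^{ -1}$. A $p$-$S$-ring over a $p$-group is one all of whose basic sets have $p$-power size. $O_\theta(\mathcal{A})=\{g\in G:\{g\}\in\mathcal{S}(\mathcal{A})\}$ (the thin radical). An $\mathcal{A}$-subgroup is a subgroup $H$ with $\underline{H}\in\mathcal{A}$; for $\mathcal{A}$-subgroups $L\trianglelefteq U$, $\mathcal{A}_{U/L}$ is the $S$-ring over $U/L$ whose basic sets are the images of basic sets contained in $U$ under $U\to U/L$ ($\mathcal{A}_U=\mathcal{A}_{U/\{e\}}$). $\mathcal{A}$ is the $U/L$-wreath product if $L\trianglelefteq G$ and $L\le\mathrm{rad}(X)=\{g:gX=Xg=X\}$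 for every basic set $X\not\subseteq U$. $\mathbb{Z}H$ denotes the group ring (all basic sets singletons). With $R(X)=\{(g,xg):g\in G,x\in X\}$, an isomorphism from $\mathcal{A}$ onto an $S$-ring $\mathcal{A}'$ over $G$ is a bijection of $G$ mapping $\{R(X)\}_{X\in\mathcal{S}(\mathcal{A})}$ onto $\{R(X')\}_{X'\in\mathcal{S}(\mathcal{A}')}$; $\mathrm{Aut}(\mathcal{A})$ consists of bijections fixing each $R(X)$; $\mathrm{Aut}_G(\mathcal{A})=\mathrm{Aut}(\mathcal{A})\cap\mathrm{Aut}(G)$; $\mathrm{Iso}(\mathcal{A})$ is the set of all isomorphisms from $\mathcal{A}$ onto $S$-rings over $G$; $\mathcal{A}$ is a $CI$-$S$-ring if $\mathrm{Iso}(\mathcal{A})=\mathrm{Aut}(\mathcal{A})\mathrm{Aut}(G)$. $\mathcal{A}$ is cyclotomic if $\mathcal{S}(\mathcal{A})$ is the set of orbits on $G$ of some $M\le\mathrm{Aut}(G)$; a cyclotomic $\mathcal{A}$ is Cayley minimal if $\mathrm{Aut}_G(\mathcal{A})$ is the only subgroup $K\le\mathrm{Aut}(G)$ having the same orbits on $G$ as $\mathrm{Aut}_G(\mathcal{A})$. -}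

module Defs where

open import Data.Nat using (ℕ; zero; suc; _+_; _*_; _∸_; _^_; _≡ᵇ_; NonZero)
open import Data.Nat.DivMod using (_mod_)
open import Data.Fin using (Fin; toℕ)
open import Data.Vec using (Vec; []; _∷_; zipWith; map)
open import Data.List as L using (List; concatMap; allFin; filterᵇ; length)
open import Data.Bool using (Bool; true; false; _∧_; _∨_; not)
open import Data.Product using (Σ; _×_; ∃; ∃-syntax; _,_)
open import Function.Definitions using (Bijective)
open import Relation.Binary.PropositionalEquality using (_≡_)
open import Relation.Nullary using (¬_)
open import Relation.Nullary.Decidable using (⌊_⌋)
open import Function.Bundles using (_⇔_)
import Data.Vec.Properties as VP
import Data.Fin as F
open import Data.Bool.ListAction using (and)

-- Elementary abelian group of order p^n, written additively:
-- G = (ℤ/p)^n, elements are vectors of residues mod p.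
module EA (p : ℕ) .{{_ : NonZero p}} (n : ℕ) where

  G : Set
  G = Vec (Fin p) n

  _+ₚ_ : Fin p → Fin p → Fin p
  a +ₚ b = (toℕ a + toℕ b) mod p

  negₚ : Fin p → Fin p
  negₚ a = (p ∸ toℕ a) mod p

  _⊕_ : G → G → G
  g ⊕ h = zipWith _+ₚ_ g h

  e : G
  e = Data.Vec.replicate n (0 mod p)

  ⊖_ : G → G
  ⊖ g = map negₚ g

  _≟G_ : (g h : G) → Relation.Nullary.Dec (g ≡ h)
  _≟G_ = VP.≡-dec F._≟_

  allVec : (m : ℕ) → List (Vec (Fin p) m)
  allVec zero = [] L.∷ L.[]
  allVec (suc m) = concatMap (λ a → L.map (a ∷_) (allVec m)) (allFin p)

  allG : List G
  allG = allVec n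

  count : (G → Bool) → ℕ
  count P = length (filterᵇ P allG)

  -- A partition of G is given by a labelling  lab : G → ℕ ; the
  -- basic sets are the (nonempty) fibres  {g | lab g ≡ lab x}.

  same : (G → ℕ) → G → G → Bool
  same lab g h = lab g ≡ᵇ lab h

  -- coefficient of z in  X̲ · Y̲  where X ∋ x, Y ∋ y are basic sets:
  -- #{ (a,b) ∈ X × Y | a + b = z } = #{ b ∈ Y | z - b ∈ X }
  structConst : (G → ℕ) → G → G → G → ℕ
  structConst lab x y z =
    count (λ b → same lab (z ⊕ (⊖ b)) x ∧ same lab b y)

  -- lab defines an S-ring over G:
  --  * {e} is a basic set,
  --  * the partition is closed under X ↦ X⁻¹,
  --  * the span of the X̲ is closed under multiplication, i.e. the
  --    coefficient of z in X̲·Y̲ is constant on each basic set Z.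
  record IsSRing (lab : G → ℕ) : Set where
    field
      identity-basic : ∀ g → lab g ≡ lab e → g ≡ e
      inverse-closed : ∀ g h → lab g ≡ lab h → lab (⊖ g) ≡ lab (⊖ h)
      mult-closed    : ∀ x y z z' → lab z ≡ lab z' →
                       structConst lab x y z ≡ structConst lab x y z'

  IsPSRing : (G → ℕ) → Set
  IsPSRing lab = IsSRing lab × (∀ x → ∃[ k ] count (λ g → same lab g x) ≡ p ^ k)

  -- thin radical O_θ(A): g with {g} a basic set (boolean, via allG)
  thinᵇ : (G → ℕ) → G → Bool
  thinᵇ lab g = and (L.map (λ h → not (same lab h g) ∨ ⌊ h ≟G g ⌋) allG)

  InOθ : (G → ℕ) → G → Set
  InOθ lab g = thinᵇ lab g ≡ true

  record IsSubgroup (H : G → Set) : Set where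
    field
      has-e   : H e
      ⊕-closed : ∀ g h → H g → H h → H (g ⊕ h)
      ⊖-closed : ∀ g → H g → H (⊖ g)

  IsASubgroup : (G → ℕ) → (G → Set) → Set
  IsASubgroup lab H = IsSubgroup H × (∀ g h → lab g ≡ lab h → H g → H h)

  -- l ∈ rad(X) for X the basic set of x :  l + X = X
  InRad : (G → ℕ) → G → G → Set
  InRad lab x l = ∀ y → (lab y ≡ lab x → lab (l ⊕ y) ≡ lab x)
                      × (lab (l ⊕ y) ≡ lab x → lab y ≡ lab x)

  -- A is the U/L-wreath product  (G abelian, so L ⊴ G automatically):
  -- every basic set X ⊄ U has L ≤ rad(X).
  IsWreath : (G → ℕ) → (U L : G → Set) → Set
  IsWreath lab U L =
    ∀ x → (∃[ y ] (lab y ≡ lab x × ¬ U y)) → ∀ l → L l → InRad lab x l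

  IsAutG : (G → G) → Set
  IsAutG σ = Bijective _≡_ _≡_ σ × (∀ g h → σ (g ⊕ h) ≡ σ g ⊕ σ h)

  -- Aut(A): bijections f with (g,h) ∈ R(X) ⇔ (f g, f h) ∈ R(X) for all X,
  -- where (g,h) ∈ R(X) iff h - g ∈ X.
  IsAutA : (G → ℕ) → (G → G) → Set
  IsAutA lab f = Bijective _≡_ _≡_ f ×
                 (∀ g h → lab (f h ⊕ (⊖ f g)) ≡ lab (h ⊕ (⊖ g)))

  -- isomorphism from A (lab) onto A' (lab'): a bijection mapping the
  -- family {R(X)} onto the family {R(X')}.
  IsIso : (G → ℕ) → (G → ℕ) → (G → G) → Set
  IsIso lab lab' f = Bijective _≡_ _≡_ f ×
    (∀ g h g' h' → (lab (h ⊕ (⊖ g)) ≡ lab (h' ⊕ (⊖ g')))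
                 ⇔ (lab' (f h ⊕ (⊖ f g)) ≡ lab' (f h' ⊕ (⊖ f g'))))

  -- CI-S-ring: Iso(A) = Aut(A) Aut(G)  (product: first a ∈ Aut(A), then σ)
  IsCI : (G → ℕ) → Set
  IsCI lab = ∀ (lab' : G → ℕ) → IsSRing lab' → ∀ f → IsIso lab lab' f →
             ∃[ a ] ∃[ σ ] (IsAutA lab a × IsAutG σ × (∀ g → f g ≡ σ (a g)))

  record IsAutSubgroup (K : (G → G) → Set) : Set where
    field
      auts      : ∀ σ → K σ → IsAutG σ
      extensional : ∀ σ τ → K σ → (∀ g → σ g ≡ τ g) → K τ
      has-id    : K (λ g → g)
      ∘-closed  : ∀ σ τ → K σ → K τ → K (λ g → σ (τ g))
      inv-closed : ∀ σ → K σ → ∃[ τ ] (K τ × (∀ g → τ (σ g) ≡ g))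

  SameOrbit : ((G → G) → Set) → G → G → Set
  SameOrbit K g h = ∃[ σ ] (K σ × σ g ≡ h)

  IsCyclotomic : (G → ℕ) → Set₁
  IsCyclotomic lab = ∃[ M ] (IsAutSubgroup M ×
                      (∀ g h → (lab g ≡ lab h) ⇔ SameOrbit M g h))

  AutGA : (G → ℕ) → (G → G) → Set
  AutGA lab σ = IsAutA lab σ × IsAutG σ

  IsCayleyMinimal : (G → ℕ) → Set₁
  IsCayleyMinimal lab = IsCyclotomic lab ×
    (∀ K → IsAutSubgroup K →
       (∀ g h → SameOrbit K g h ⇔ SameOrbit (AutGA lab) g h) →
       ∀ σ → K σ ⇔ AutGA lab σ)

open EA public

module Submission where

-- Fix a non-thin c.  As |O_θ|·p = |G|, the cosets O_θ + k·c (k < p)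
-- partition G; idx g is the k with g ∈ O_θ + k·c.  Translation by a thin
-- element permutes the basic sets, so a basic set X ∋ x meets each coset in
-- ∅ or a translate of R(x) = {h ∈ O_θ : x + h ∈ X}; since |X| is a power of
-- p and X misses O_θ (x non-thin), X = x + R(x) lies in one coset.  The
-- support of X̲·Y̲ gives R(x + y) ⊆ R(x) + R(y), whence R(x) = R(c) =: L for
-- all non-thin x: this is part (1).  For (2), the shears g ↦ g + idx(g)·l
-- (l ∈ L) realise the basic sets as Aut_G(A)-orbits; an element of Aut_G(A)
-- is determined by its value at c (minimality); and an isomorphism f splits
-- as σ ∘ a with σ ∈ Aut(G), a ∈ Aut(A) (CI).

import Defs
open import Data.Bool using (Bool; true; false; _∧_; _∨_)
open import Data.Empty using (⊥; ⊥-elim)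
open import Data.List using (List)
open import Data.List.Membership.Propositional using (_∈_)
open import Data.List.Relation.Unary.Unique.Propositional using (Unique)
open import Data.Nat using (ℕ; zero; suc; _+_; _≤_; _<_; _*_; _^_; NonZero; _<ᵇ_; _≡ᵇ_)
open import Data.Nat.Coprimality as Coprime using (prime⇒coprime; coprime-divisor)
open import Data.Nat.Divisibility using (_∣_; ∣1⇒≡1)
open import Data.Nat.Primality using (Prime; prime⇒nonZero)
open import Data.Product using (_×_; ∃-syntax; _,_; proj₁; proj₂)
open import Data.Sum using (_⊎_; inj₁; inj₂)
open import Function using (_⇔_; mk⇔; Equivalence)
open import Relation.Binary.PropositionalEquality using (_≡_; refl; sym)

bool-ext : ∀ {a b : Bool} → (a ≡ true ⇔ b ≡ true) → a ≡ b
bool-ext {false} {false} _   = refl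
bool-ext {false} {true}  a⇔b = Equivalence.from a⇔b refl
bool-ext {true}  {false} a⇔b = sym (Equivalence.to a⇔b refl)
bool-ext {true}  {true}  _   = refl

∧⇔ : ∀ {a b} → a ∧ b ≡ true ⇔ (a ≡ true × b ≡ true)
∧⇔ {true}  = mk⇔ (λ b≡true → refl , b≡true) proj₂
∧⇔ {false} = mk⇔ (λ ()) (λ ())

<ᵇ-zero : ∀ i → (i <ᵇ zero) ≡ false
<ᵇ-zero zero    = refl
<ᵇ-zero (suc i) = refl

<ᵇ-suc : ∀ i m → (i <ᵇ suc m) ≡ (i <ᵇ m) ∨ (i ≡ᵇ m)
<ᵇ-suc zero    zero    = refl
<ᵇ-suc zero    (suc m) = refl
<ᵇ-suc (suc i) zero    = refl
<ᵇ-suc (suc i) (suc m) = <ᵇ-suc i m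

<ᵇ-≡ᵇ-disjoint : ∀ i m → (i <ᵇ m) ≡ true → (i ≡ᵇ m) ≡ true → ⊥
<ᵇ-≡ᵇ-disjoint zero    zero    ()  _
<ᵇ-≡ᵇ-disjoint zero    (suc m) _   ()
<ᵇ-≡ᵇ-disjoint (suc i) zero    ()  _
<ᵇ-≡ᵇ-disjoint (suc i) (suc m) i<m i≡m = <ᵇ-≡ᵇ-disjoint i m i<m i≡m

module Bijections {A : Set} where

  open import Function.Definitions using (Bijective)
  open import Function.Consequences.Propositional using (strictlySurjective⇒surjective)
  open import Relation.Binary.PropositionalEquality using (trans; cong)

  bijective : ∀ (f g : A → A) → (∀ x → g (f x) ≡ x) → (∀ y → f (g y) ≡ y) → Bijective _≡_ _≡_ f
  bijective f g g∘f≡id f∘g≡id =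
    (λ {x} {y} fx≡fy → trans (sym (g∘f≡id x)) (trans (cong g fx≡fy) (g∘f≡id y))) ,
    strictlySurjective⇒surjective (λ y → g y , f∘g≡id y)

  inverse : ∀ (f : A → A) → Bijective _≡_ _≡_ f → A → A
  inverse f (_ , surjective) y = proj₁ (surjective y)

  inverse-right : ∀ f (bij : Bijective _≡_ _≡_ f) y → f (inverse f bij y) ≡ y
  inverse-right f (_ , surjective) y = proj₂ (surjective y) refl

  inverse-left : ∀ f (bij : Bijective _≡_ _≡_ f) x → inverse f bij (f x) ≡ x
  inverse-left f bij x = proj₁ bij (inverse-right f bij (f x))

sumBelow : ℕ → (ℕ → ℕ) → ℕ
sumBelow zero    v = 0
sumBelow (suc m) v = sumBelow m v + v m

small-divisor-of-prime-power : ∀ {p} → Prime p → ∀ s k → 0 < s → s < p → s ∣ p ^ k → s ≡ 1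
small-divisor-of-prime-power p-prime s zero    _   _   s∣1   = ∣1⇒≡1 s∣1
small-divisor-of-prime-power p-prime s@(suc _) (suc k) 0<s s<p s∣pᵏ⁺¹ =
  small-divisor-of-prime-power p-prime s k 0<s s<p
    (coprime-divisor (Coprime.sym (prime⇒coprime p-prime s<p)) s∣pᵏ⁺¹)

-- If v 0, …, v (p-1) each equal 0 or r, v 0 = 0, and their sum is a power
-- of the prime p, then at most one of them is nonzero: the number s of
-- nonzero terms satisfies s * r = p ^ k and s < p, so s = 1.
module EqualParts {p : ℕ} (p-prime : Prime p) (v : ℕ → ℕ) (r : ℕ)
                  (zero-or-r : ∀ j → v j ≡ 0 ⊎ v j ≡ r) where

  open import Data.Nat using (pred; z≤n; s≤s; s≤s⁻¹)
  open import Data.Nat.Properties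
  open import Data.Nat.Divisibility using (divides)
  open import Relation.Nullary using (¬_; yes; no)
  open import Relation.Binary.PropositionalEquality

  indicator : ℕ → ℕ
  indicator j with v j ≟ 0
  ... | yes _ = 0
  ... | no  _ = 1

  nonzeros : ℕ → ℕ
  nonzeros m = sumBelow m indicator

  v≡indicator*r : ∀ j → v j ≡ indicator j * r
  v≡indicator*r j with v j ≟ 0 | zero-or-r j
  ... | yes vj≡0 | _         = vj≡0
  ... | no  vj≢0 | inj₁ vj≡0 = ⊥-elim (vj≢0 vj≡0)
  ... | no  _    | inj₂ vj≡r = trans vj≡r (sym (+-identityʳ r))

  indicator-nonzero : ∀ j → ¬ v j ≡ 0 → indicator j ≡ 1
  indicator-nonzero j vj≢0 with v j ≟ 0
  ... | yes vj≡0 = ⊥-elim (vj≢0 vj≡0)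
  ... | no  _    = refl

  indicator≤1 : ∀ j → indicator j ≤ 1
  indicator≤1 j with v j ≟ 0
  ... | yes _ = z≤n
  ... | no  _ = s≤s z≤n

  sum≡nonzeros*r : ∀ m → sumBelow m v ≡ nonzeros m * r
  sum≡nonzeros*r zero    = refl
  sum≡nonzeros*r (suc m) = trans (cong₂ _+_ (sum≡nonzeros*r m) (v≡indicator*r m))
                                 (sym (*-distribʳ-+ r (nonzeros m) (indicator m)))

  nonzeros<p : v 0 ≡ 0 → ∀ m → nonzeros (suc m) ≤ m
  nonzeros<p v0≡0 zero with v 0 ≟ 0
  ... | yes _    = z≤n
  ... | no  v0≢0 = ⊥-elim (v0≢0 v0≡0)
  nonzeros<p v0≡0 (suc m) = subst (_≤ suc m) (+-comm (indicator (suc m)) _)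
                              (+-mono-≤ (indicator≤1 (suc m)) (nonzeros<p v0≡0 m))

  one-nonzero : ∀ j m → j < m → ¬ v j ≡ 0 → 1 ≤ nonzeros m
  one-nonzero j (suc m) j<1+m vj≢0 with m≤n⇒m<n∨m≡n (s≤s⁻¹ j<1+m)
  ... | inj₁ j<m  = ≤-trans (one-nonzero j m j<m vj≢0) (m≤m+n _ _)
  ... | inj₂ refl = subst (1 ≤_) (cong (nonzeros j +_) (sym (indicator-nonzero j vj≢0)))
                      (m≤n+m 1 _)

  last-and-earlier : ∀ m j → j < m → ¬ v m ≡ 0 → ¬ v j ≡ 0 → 2 ≤ nonzeros m + indicator m
  last-and-earlier m j j<m vm≢0 vj≢0 =
    subst (2 ≤_) (trans (+-comm 1 _) (cong (nonzeros m +_) (sym (indicator-nonzero m vm≢0))))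
      (s≤s (one-nonzero j m j<m vj≢0))

  two-nonzeros : ∀ j₀ j₁ m → j₀ < m → j₁ < m → ¬ j₀ ≡ j₁ → ¬ v j₀ ≡ 0 → ¬ v j₁ ≡ 0 →
                 2 ≤ nonzeros m
  two-nonzeros j₀ j₁ (suc m) j₀<1+m j₁<1+m j₀≢j₁ v₀≢0 v₁≢0
    with m≤n⇒m<n∨m≡n (s≤s⁻¹ j₀<1+m) | m≤n⇒m<n∨m≡n (s≤s⁻¹ j₁<1+m)
  ... | inj₁ j₀<m | inj₁ j₁<m = ≤-trans (two-nonzeros j₀ j₁ m j₀<m j₁<m j₀≢j₁ v₀≢0 v₁≢0) (m≤m+n _ _)
  ... | inj₂ refl | inj₂ refl = ⊥-elim (j₀≢j₁ refl)
  ... | inj₂ refl | inj₁ j₁<m = last-and-earlier j₀ j₁ j₁<m v₀≢0 v₁≢0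
  ... | inj₁ j₀<m | inj₂ refl = last-and-earlier j₁ j₀ j₀<m v₁≢0 v₀≢0

  at-most-one-nonzero : v 0 ≡ 0 → ∀ k → sumBelow p v ≡ p ^ k →
                        ∀ {j₀ j₁} → j₀ < p → j₁ < p → ¬ v j₀ ≡ 0 → ¬ v j₁ ≡ 0 → j₀ ≡ j₁
  at-most-one-nonzero v0≡0 k sum≡pᵏ {j₀} {j₁} j₀<p j₁<p v₀≢0 v₁≢0 with j₀ ≟ j₁
  ... | yes j₀≡j₁ = j₀≡j₁
  ... | no  j₀≢j₁ = ⊥-elim (<-irrefl (sym s≡1) (two-nonzeros j₀ j₁ p j₀<p j₁<p j₀≢j₁ v₀≢0 v₁≢0))
    where
    s = nonzeros p
    s<p : s < p
    s<p = subst (λ q → suc (nonzeros q) ≤ q) (suc-pred p {{prime⇒nonZero p-prime}})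
            (s≤s (nonzeros<p v0≡0 (pred p)))
    s≡1 : s ≡ 1
    s≡1 = small-divisor-of-prime-power p-prime s k (one-nonzero j₀ p j₀<p v₀≢0) s<p
            (divides r (trans (sym sum≡pᵏ) (trans (sum≡nonzeros*r p) (*-comm s r))))

module Counting {A : Set} (xs : List A) (unique : Unique xs) (complete : ∀ x → x ∈ xs) where

  open import Data.Bool using (T; T?)
  open import Data.Bool.Properties using (T-≡; ∧-zeroʳ; ∧-identityʳ; ∧-distribˡ-∨)
  open import Data.List using ([]; _∷_; filterᵇ; length; map)
  open import Data.List.Properties
    using (filter-≐; filter-none; filter-all; filter-notAll; filter-some)
  open import Data.List.Relation.Unary.All using (tabulate)
  open import Data.List.Relation.Unary.Any using (here) renaming (map to any-map)
  import Data.List.Membership.Propositional.Properties as ∈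
  open import Data.List.Membership.Propositional.Properties.WithK using (unique∧set⇒bag)
  open import Data.List.Relation.Binary.BagAndSetEquality using (∼bag⇒↭)
  open import Data.List.Relation.Binary.Permutation.Propositional using (_↭_)
  open import Data.List.Relation.Binary.Permutation.Propositional.Properties using (↭-length; filter-↭)
  import Data.List.Relation.Unary.Unique.Propositional.Properties as Unique
  open import Data.Nat.Properties
    using (+-suc; +-comm; <-irrefl; ≤-refl; ≤-trans; n≤1+n; m≤n⇒m≤1+n; <⇒<ᵇ)
  open import Function using (_∘_)
  open import Relation.Binary.PropositionalEquality
  open import Relation.Nullary using (¬_)
  open Equivalence

  count : (A → Bool) → ℕ
  count P = length (filterᵇ P xs)

  count-ext : ∀ P Q → (∀ x → P x ≡ Q x) → count P ≡ count Q
  count-ext P Q P≗Q = cong length (filter-≐ (T? ∘ P) (T? ∘ Q)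
    ((λ {x} → subst T (P≗Q x)) , (λ {x} → subst T (sym (P≗Q x)))) xs)

  count-none : ∀ P → (∀ x → P x ≡ false) → count P ≡ 0
  count-none P none = cong length (filter-none (T? ∘ P) {xs} (tabulate λ {x} _ → subst T (none x)))

  count-all : ∀ P → (∀ x → P x ≡ true) → count P ≡ length xs
  count-all P all = cong length (filter-all (T? ∘ P) {xs} (tabulate λ {x} _ → from T-≡ (all x)))

  count-all⁻ : ∀ P → count P ≡ length xs → ∀ x → P x ≡ true
  count-all⁻ P full x with P x in Px
  ... | true = refl
  ... | false = ⊥-elim (<-irrefl full (filter-notAll (T? ∘ P) xs
                  (any-map (λ { refl TPx → subst T Px TPx }) (complete x))))

  count-pos : ∀ P x → P x ≡ true → 0 < count P
  count-pos P x Px = filter-some (T? ∘ P) (any-map (λ { refl → from T-≡ Px }) (complete x))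

  count-witness : ∀ P → ¬ count P ≡ 0 → ∃[ x ] P x ≡ true
  count-witness P nonzero with filterᵇ P xs in eq
  ... | [] = ⊥-elim (nonzero refl)
  ... | y ∷ _ = y , to T-≡
                  (proj₂ (∈.∈-filter⁻ (T? ∘ P) {xs = xs} (subst (y ∈_) (sym eq) (here refl))))

  count-∨ : ∀ P Q → (∀ x → P x ≡ true → Q x ≡ true → ⊥) →
            count (λ x → P x ∨ Q x) ≡ count P + count Q
  count-∨ P Q disjoint = go xs
    where
    go : ∀ ys → length (filterᵇ (λ x → P x ∨ Q x) ys) ≡ length (filterᵇ P ys) + length (filterᵇ Q ys)
    go [] = refl
    go (y ∷ ys) with P y in Py | Q y in Qy
    ... | true  | true  = ⊥-elim (disjoint y Py Qy)
    ... | true  | false = cong suc (go ys)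
    ... | false | true  = trans (cong suc (go ys)) (sym (+-suc _ _))
    ... | false | false = go ys

  count-bij : ∀ P (f : A → A) → (∀ {x y} → f x ≡ f y → x ≡ y) → (∀ y → ∃[ x ] f x ≡ y) →
              count (P ∘ f) ≡ count P
  count-bij P f injective surjective = trans (sym (count-map xs)) (↭-length (filter-↭ (T? ∘ P) map-f-xs↭xs))
    where
    count-map : ∀ ys → length (filterᵇ P (map f ys)) ≡ length (filterᵇ (P ∘ f) ys)
    count-map [] = refl
    count-map (y ∷ ys) with P (f y)
    ... | true  = cong suc (count-map ys)
    ... | false = count-map ys
    covers : ∀ y → y ∈ map f xs
    covers y = let (x , fx≡y) = surjective y in subst (_∈ map f xs) fx≡y (∈.∈-map⁺ f (complete x))
    map-f-xs↭xs : map f xs ↭ xs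
    map-f-xs↭xs = ∼bag⇒↭ (unique∧set⇒bag (Unique.map⁺ injective unique) unique
                     (λ {y} → mk⇔ (λ _ → complete y) (λ _ → covers y)))

  count-split : ∀ P (f : A → ℕ) M → (∀ x → f x < M) →
                count P ≡ sumBelow M (λ j → count (λ x → P x ∧ (f x ≡ᵇ j)))
  count-split P f M f<M = trans (count-ext _ _ below-M) (split M)
    where
    below-M : ∀ x → P x ≡ P x ∧ (f x <ᵇ M)
    below-M x = sym (trans (cong (P x ∧_) (to T-≡ (<⇒<ᵇ (f<M x)))) (∧-identityʳ (P x)))
    split : ∀ m → count (λ x → P x ∧ (f x <ᵇ m)) ≡ sumBelow m (λ j → count (λ x → P x ∧ (f x ≡ᵇ j)))
    split zero    = count-none _ (λ x → trans (cong (P x ∧_) (<ᵇ-zero (f x))) (∧-zeroʳ (P x)))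
    split (suc m) = begin
      count (λ x → P x ∧ (f x <ᵇ suc m))
        ≡⟨ count-ext _ _ (λ x → trans (cong (P x ∧_) (<ᵇ-suc (f x) m)) (∧-distribˡ-∨ (P x) _ _)) ⟩
      count (λ x → (P x ∧ (f x <ᵇ m)) ∨ (P x ∧ (f x ≡ᵇ m)))
        ≡⟨ count-∨ _ _ (λ x below at → <ᵇ-≡ᵇ-disjoint (f x) m (proj₂ (to ∧⇔ below)) (proj₂ (to ∧⇔ at))) ⟩
      count (λ x → P x ∧ (f x <ᵇ m)) + count (λ x → P x ∧ (f x ≡ᵇ m))
        ≡⟨ cong (_+ count (λ x → P x ∧ (f x ≡ᵇ m))) (split m) ⟩
      sumBelow (suc m) (λ j → count (λ x → P x ∧ (f x ≡ᵇ j))) ∎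
      where open ≡-Reasoning

  count-cover : ∀ (C : ℕ → A → Bool) M N →
    (∀ {k m} x → k < m → m < M → C k x ≡ true → C m x ≡ true → ⊥) →
    (∀ k → count (C k) ≡ N) → M * N ≡ length xs →
    ∀ x → ∃[ k ] (k < M × C k x ≡ true)
  count-cover C M N disjoint size total x =
    search M x (count-all⁻ (union M) (trans (count-union M ≤-refl) total) x)
    where
    union : ℕ → A → Bool
    union zero    x = false
    union (suc m) x = union m x ∨ C m x
    search : ∀ m x → union m x ≡ true → ∃[ k ] (k < m × C k x ≡ true)
    search (suc m) x in-union with union m x in earlier
    ... | true  = let (k , k<m , Ckx) = search m x earlier in k , m≤n⇒m≤1+n k<m , Ckx
    ... | false = m , ≤-refl , in-union
    count-union : ∀ m → m ≤ M → count (union m) ≡ m * N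
    count-union zero    _     = count-none _ (λ _ → refl)
    count-union (suc m) m<M = begin
      count (union (suc m))        ≡⟨ count-∨ (union m) (C m) (λ x earlier now →
                                        let (k , k<m , Ckx) = search m x earlier in disjoint x k<m m<M Ckx now) ⟩
      count (union m) + count (C m) ≡⟨ cong₂ _+_ (count-union m (≤-trans (n≤1+n m) m<M)) (size m) ⟩
      m * N + N                     ≡⟨ +-comm (m * N) N ⟩
      suc m * N                     ∎
      where open ≡-Reasoning

module Residues (p : ℕ) .{{_ : NonZero p}} where

  open import Algebra.Bundles using (AbelianGroup)
  open import Data.Nat using (_∸_; _%_)
  open import Data.Nat.Properties using (+-comm; +-assoc; *-comm; m+[n∸m]≡n; <⇒≤)
  open import Data.Nat.DivMod
  open import Data.Fin using (Fin; toℕ)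
  open import Data.Fin.Properties using (toℕ-injective; toℕ-fromℕ<; toℕ<n)
  open import Relation.Binary.PropositionalEquality
  open Defs.EA p 0 using (_+ₚ_; negₚ)
  open ≡-Reasoning

  0ₚ : Fin p
  0ₚ = 0 mod p

  toℕ-mod : ∀ m → toℕ (m mod p) ≡ m % p
  toℕ-mod m = toℕ-fromℕ< (m%n<n m p)

  toℕ-0ₚ : toℕ 0ₚ ≡ 0
  toℕ-0ₚ = trans (toℕ-mod 0) (m*n%n≡0 0 p)

  %-absorbˡ : ∀ m n → (m % p + n) % p ≡ (m + n) % p
  %-absorbˡ m n = begin
    (m % p + n) % p           ≡⟨ %-distribˡ-+ (m % p) n p ⟩
    (m % p % p + n % p) % p   ≡⟨ cong (λ k → (k + n % p) % p) (m%n%n≡m%n m p) ⟩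
    (m % p + n % p) % p       ≡⟨ %-distribˡ-+ m n p ⟨
    (m + n) % p               ∎

  %-absorbʳ : ∀ m n → (m + n % p) % p ≡ (m + n) % p
  %-absorbʳ m n = begin
    (m + n % p) % p ≡⟨ cong (_% p) (+-comm m (n % p)) ⟩
    (n % p + m) % p ≡⟨ %-absorbˡ n m ⟩
    (n + m) % p     ≡⟨ cong (_% p) (+-comm n m) ⟩
    (m + n) % p     ∎

  +ₚ-assoc : ∀ a b c → (a +ₚ b) +ₚ c ≡ a +ₚ (b +ₚ c)
  +ₚ-assoc a b c = toℕ-injective (begin
    toℕ ((a +ₚ b) +ₚ c)                 ≡⟨ toℕ-mod _ ⟩
    (toℕ (a +ₚ b) + toℕ c) % p          ≡⟨ cong (λ k → (k + toℕ c) % p) (toℕ-mod _) ⟩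
    ((toℕ a + toℕ b) % p + toℕ c) % p   ≡⟨ %-absorbˡ (toℕ a + toℕ b) (toℕ c) ⟩
    (toℕ a + toℕ b + toℕ c) % p         ≡⟨ cong (_% p) (+-assoc (toℕ a) (toℕ b) (toℕ c)) ⟩
    (toℕ a + (toℕ b + toℕ c)) % p       ≡⟨ %-absorbʳ (toℕ a) (toℕ b + toℕ c) ⟨
    (toℕ a + (toℕ b + toℕ c) % p) % p   ≡⟨ cong (λ k → (toℕ a + k) % p) (toℕ-mod _) ⟨
    (toℕ a + toℕ (b +ₚ c)) % p          ≡⟨ toℕ-mod _ ⟨
    toℕ (a +ₚ (b +ₚ c))                 ∎)

  +ₚ-comm : ∀ a b → a +ₚ b ≡ b +ₚ a
  +ₚ-comm a b = cong (_mod p) (+-comm (toℕ a) (toℕ b))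

  +ₚ-identityˡ : ∀ a → 0ₚ +ₚ a ≡ a
  +ₚ-identityˡ a = toℕ-injective (begin
    toℕ (0ₚ +ₚ a)          ≡⟨ toℕ-mod _ ⟩
    (toℕ 0ₚ + toℕ a) % p   ≡⟨ cong (λ k → (k + toℕ a) % p) toℕ-0ₚ ⟩
    toℕ a % p              ≡⟨ m<n⇒m%n≡m (toℕ<n a) ⟩
    toℕ a                  ∎)

  +ₚ-inverseʳ : ∀ a → a +ₚ negₚ a ≡ 0ₚ
  +ₚ-inverseʳ a = toℕ-injective (begin
    toℕ (a +ₚ negₚ a)                 ≡⟨ toℕ-mod _ ⟩
    (toℕ a + toℕ (negₚ a)) % p        ≡⟨ cong (λ k → (toℕ a + k) % p) (toℕ-mod _) ⟩
    (toℕ a + (p ∸ toℕ a) % p) % p     ≡⟨ %-absorbʳ (toℕ a) (p ∸ toℕ a) ⟩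
    (toℕ a + (p ∸ toℕ a)) % p         ≡⟨ cong (_% p) (m+[n∸m]≡n (<⇒≤ (toℕ<n a))) ⟩
    p % p                             ≡⟨ n%n≡0 p ⟩
    0                                 ≡⟨ toℕ-0ₚ ⟨
    toℕ 0ₚ                            ∎)

  residueGroup : AbelianGroup _ _
  residueGroup = record
    { Carrier = Fin p ; _≈_ = _≡_ ; _∙_ = _+ₚ_ ; ε = 0ₚ ; _⁻¹ = negₚ
    ; isAbelianGroup = record
      { isGroup = record
        { isMonoid = record
          { isSemigroup = record
            { isMagma = record { isEquivalence = isEquivalence ; ∙-cong = cong₂ _+ₚ_ }
            ; assoc = +ₚ-assoc }
          ; identity = +ₚ-identityˡ , λ a → trans (+ₚ-comm a 0ₚ) (+ₚ-identityˡ a) }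
        ; inverse = (λ a → trans (+ₚ-comm (negₚ a) a) (+ₚ-inverseʳ a)) , +ₚ-inverseʳ
        ; ⁻¹-cong = cong negₚ }
      ; comm = +ₚ-comm } }

  open import Algebra.Properties.Monoid.Mult (AbelianGroup.monoid residueGroup)
    public using () renaming (_×_ to _·ₚ_)

  toℕ-·ₚ : ∀ k a → toℕ (k ·ₚ a) ≡ (k * toℕ a) % p
  toℕ-·ₚ zero a = trans toℕ-0ₚ (sym (m*n%n≡0 0 p))
  toℕ-·ₚ (suc k) a = begin
    toℕ (a +ₚ (k ·ₚ a))              ≡⟨ toℕ-mod _ ⟩
    (toℕ a + toℕ (k ·ₚ a)) % p       ≡⟨ cong (λ m → (toℕ a + m) % p) (toℕ-·ₚ k a) ⟩
    (toℕ a + (k * toℕ a) % p) % p    ≡⟨ %-absorbʳ (toℕ a) (k * toℕ a) ⟩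
    (toℕ a + k * toℕ a) % p          ∎

  p·ₚa≡0ₚ : ∀ a → p ·ₚ a ≡ 0ₚ
  p·ₚa≡0ₚ a = toℕ-injective (begin
    toℕ (p ·ₚ a)        ≡⟨ toℕ-·ₚ p a ⟩
    (p * toℕ a) % p     ≡⟨ cong (_% p) (*-comm p (toℕ a)) ⟩
    (toℕ a * p) % p     ≡⟨ m*n%n≡0 (toℕ a) p ⟩
    0                   ≡⟨ toℕ-0ₚ ⟨
    toℕ 0ₚ              ∎)

module ElementaryAbelian (p : ℕ) .{{_ : NonZero p}} (n : ℕ) where

  open import Algebra.Bundles using (AbelianGroup)
  open import Data.Vec.Properties
    using (zipWith-assoc; zipWith-comm; zipWith-identityˡ; zipWith-identityʳ;
           zipWith-inverseˡ; zipWith-inverseʳ)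
  open import Relation.Binary.PropositionalEquality
  open Defs.EA p n
  open Residues p using (residueGroup)
  open AbelianGroup residueGroup using () renaming
    (assoc to +ₚ-assoc; comm to +ₚ-comm; identityˡ to +ₚ-identityˡ;
     identityʳ to +ₚ-identityʳ; inverseˡ to +ₚ-inverseˡ; inverseʳ to +ₚ-inverseʳ)

  groupG : AbelianGroup _ _
  groupG = record
    { Carrier = G ; _≈_ = _≡_ ; _∙_ = _⊕_ ; ε = e ; _⁻¹ = ⊖_
    ; isAbelianGroup = record
      { isGroup = record
        { isMonoid = record
          { isSemigroup = record
            { isMagma = record { isEquivalence = isEquivalence ; ∙-cong = cong₂ _⊕_ }
            ; assoc = zipWith-assoc +ₚ-assoc }
          ; identity = zipWith-identityˡ +ₚ-identityˡ , zipWith-identityʳ +ₚ-identityʳ }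
        ; inverse = zipWith-inverseˡ +ₚ-inverseˡ , zipWith-inverseʳ +ₚ-inverseʳ
        ; ⁻¹-cong = cong ⊖_ }
      ; comm = zipWith-comm +ₚ-comm } }

  open AbelianGroup groupG public
    using (_-_; assoc; comm; identityˡ; identityʳ; inverseˡ; inverseʳ)
  open import Algebra.Properties.AbelianGroup groupG public
  open import Algebra.Properties.CommutativeSemigroup
    (AbelianGroup.commutativeSemigroup groupG) public
  open import Algebra.Properties.CommutativeMonoid.Mult
    (AbelianGroup.commutativeMonoid groupG) public renaming (_×_ to infixr 30 _·_)

-- G has exponent p.  The multiples of a vector are computed coordinatewise,
-- so this is proved by induction on the length for all lengths at once.
module Exponent (p : ℕ) .{{_ : NonZero p}} where

  open import Data.Fin using (Fin)
  open import Data.Vec using (Vec; []; _∷_)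
  open import Relation.Binary.PropositionalEquality
  open Residues p using (_·ₚ_; p·ₚa≡0ₚ)
  open module EAm {m} = ElementaryAbelian p m using (_·_)
  open module Ops {m} = Defs.EA p m using (_⊕_; e)

  ·-∷ : ∀ {m} k a (g : Vec (Fin p) m) → k · (a ∷ g) ≡ (k ·ₚ a) ∷ (k · g)
  ·-∷ zero a g = refl
  ·-∷ (suc k) a g = cong ((a ∷ g) ⊕_) (·-∷ k a g)

  p·g≡e : ∀ {m} (g : Vec (Fin p) m) → p · g ≡ e
  p·g≡e [] with p · []
  ... | [] = refl
  p·g≡e (a ∷ g) = trans (·-∷ p a g) (cong₂ _∷_ (p·ₚa≡0ₚ a) (p·g≡e g))

module GroupG (p : ℕ) .{{_ : NonZero p}} (n : ℕ) where

  open import Data.Nat using (_∸_; _%_; _/_)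
  open import Data.Nat.Properties using (*-assoc; suc-pred; m∸n+n≡m)
  open import Data.Nat.DivMod using (m≡m%n+[m/n]*n)
  open import Data.Nat.Coprimality using (coprime-Bézout)
  open import Data.Nat.GCD using (module Bézout)
  open import Relation.Binary.PropositionalEquality
  open Defs.EA p n
  open ElementaryAbelian p n public
  open Exponent p public using (p·g≡e)
  open ≡-Reasoning

  add-diff : ∀ a b → b ⊕ (a - b) ≡ a
  add-diff a b = trans (comm b (a - b)) (//-rightDividesˡ b a)

  diff-e : ∀ g → g - e ≡ g
  diff-e g = trans (cong (g ⊕_) ε⁻¹≈ε) (identityʳ g)

  diff-⊕ : ∀ a b c d → (a ⊕ b) - (c ⊕ d) ≡ (a - c) ⊕ (b - d)
  diff-⊕ a b c d = begin
    (a ⊕ b) ⊕ (⊖ (c ⊕ d))      ≡⟨ cong ((a ⊕ b) ⊕_) (⁻¹-∙-comm c d) ⟨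
    (a ⊕ b) ⊕ ((⊖ c) ⊕ (⊖ d))  ≡⟨ interchange a b (⊖ c) (⊖ d) ⟩
    (a - c) ⊕ (b - d)          ∎

  diff-translate : ∀ a b t → (a ⊕ t) - (b ⊕ t) ≡ a - b
  diff-translate a b t = begin
    (a ⊕ t) - (b ⊕ t)    ≡⟨ diff-⊕ a t b t ⟩
    (a - b) ⊕ (t - t)    ≡⟨ cong ((a - b) ⊕_) (inverseʳ t) ⟩
    (a - b) ⊕ e          ≡⟨ identityʳ (a - b) ⟩
    a - b                ∎

  diff-diff : ∀ g a b → (g - a) - (g - b) ≡ b - a
  diff-diff g a b = begin
    (g - a) - (g - b)        ≡⟨ diff-⊕ g (⊖ a) g (⊖ b) ⟩
    (g - g) ⊕ (⊖ a - ⊖ b)    ≡⟨ cong₂ _⊕_ (inverseʳ g) (cong ((⊖ a) ⊕_) (⁻¹-involutive b)) ⟩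
    e ⊕ ((⊖ a) ⊕ b)          ≡⟨ identityˡ ((⊖ a) ⊕ b) ⟩
    (⊖ a) ⊕ b                ≡⟨ comm (⊖ a) b ⟩
    b - a                    ∎

  diff-chain : ∀ a b c → (a - b) ⊕ (b - c) ≡ a - c
  diff-chain a b c = begin
    (a - b) ⊕ (b - c)          ≡⟨ assoc a (⊖ b) (b - c) ⟩
    a ⊕ ((⊖ b) ⊕ (b - c))      ≡⟨ cong (a ⊕_) (\\-leftDividesʳ b (⊖ c)) ⟩
    a - c                      ∎

  ·-e : ∀ k → k · e ≡ e
  ·-e zero = refl
  ·-e (suc k) = trans (cong (e ⊕_) (·-e k)) (identityˡ e)

  ·-⊖ : ∀ k g → k · (⊖ g) ≡ ⊖ (k · g)
  ·-⊖ k g = inverseʳ-unique (k · g) (k · (⊖ g)) (begin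
    k · g ⊕ k · (⊖ g)   ≡⟨ ×-distrib-+ g (⊖ g) k ⟨
    k · (g ⊕ (⊖ g))     ≡⟨ cong (k ·_) (inverseʳ g) ⟩
    k · e               ≡⟨ ·-e k ⟩
    e                   ∎)

  ·-*p : ∀ x g → (x * p) · g ≡ e
  ·-*p x g = begin
    (x * p) · g    ≡⟨ ×-assocˡ g x p ⟨
    x · (p · g)    ≡⟨ cong (x ·_) (p·g≡e g) ⟩
    x · e          ≡⟨ ·-e x ⟩
    e              ∎

  ·-mod : ∀ k g → (k % p) · g ≡ k · g
  ·-mod k g = begin
    (k % p) · g                    ≡⟨ identityʳ _ ⟨
    (k % p) · g ⊕ e                ≡⟨ cong ((k % p) · g ⊕_) (·-*p (k / p) g) ⟨
    (k % p) · g ⊕ (k / p * p) · g  ≡⟨ ×-homo-+ g (k % p) (k / p * p) ⟨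
    (k % p + k / p * p) · g        ≡⟨ cong (_· g) (m≡m%n+[m/n]*n k p) ⟨
    k · g                          ∎

  ·-∸ : ∀ m k g → k ≤ m → m · g - k · g ≡ (m ∸ k) · g
  ·-∸ m k g k≤m = begin
    m · g - k · g                   ≡⟨ cong (λ j → j · g - k · g) (m∸n+n≡m k≤m) ⟨
    (m ∸ k + k) · g - k · g         ≡⟨ cong (_- k · g) (×-homo-+ g (m ∸ k) k) ⟩
    ((m ∸ k) · g ⊕ k · g) - k · g   ≡⟨ //-rightDividesʳ (k · g) ((m ∸ k) · g) ⟩
    (m ∸ k) · g                     ∎

  ·-pred-p : ∀ g → (p ∸ 1) · g ≡ ⊖ g
  ·-pred-p g = inverseʳ-unique g ((p ∸ 1) · g) (begin
    suc (p ∸ 1) · g   ≡⟨ cong (_· g) (suc-pred p) ⟩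
    p · g             ≡⟨ p·g≡e g ⟩
    e                 ∎)

  residue-inverse : Prime p → ∀ k → 0 < k → k < p → ∃[ m ] (∀ g → (m * k) · g ≡ g)
  residue-inverse p-prime k@(suc _) _ k<p with coprime-Bézout (prime⇒coprime p-prime k<p)
  ... | Bézout.-+ x y 1+xp≡yk = y , λ g → begin
    (y * k) · g       ≡⟨ cong (_· g) 1+xp≡yk ⟨
    g ⊕ (x * p) · g   ≡⟨ cong (g ⊕_) (·-*p x g) ⟩
    g ⊕ e             ≡⟨ identityʳ g ⟩
    g                 ∎
  ... | Bézout.+- x y 1+yk≡xp = (p ∸ 1) * y , λ g → begin
    ((p ∸ 1) * y * k) · g      ≡⟨ cong (_· g) (*-assoc (p ∸ 1) y k) ⟩
    ((p ∸ 1) * (y * k)) · g    ≡⟨ ×-assocˡ g (p ∸ 1) (y * k) ⟨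
    (p ∸ 1) · ((y * k) · g)    ≡⟨ cong ((p ∸ 1) ·_) (yk-acts-as-minus-one g) ⟩
    (p ∸ 1) · (⊖ g)            ≡⟨ ·-pred-p (⊖ g) ⟩
    ⊖ (⊖ g)                    ≡⟨ ⁻¹-involutive g ⟩
    g                          ∎
    where
    yk-acts-as-minus-one : ∀ g → (y * k) · g ≡ ⊖ g
    yk-acts-as-minus-one g = inverseʳ-unique g ((y * k) · g)
      (trans (cong (_· g) 1+yk≡xp) (·-*p x g))

module AutomorphismsG (p : ℕ) .{{_ : NonZero p}} (n : ℕ) where

  open import Relation.Binary.PropositionalEquality
  open Defs.EA p n
  open GroupG p n
  open Bijections
  open ≡-Reasoning

  IsHom : (G → G) → Set
  IsHom σ = ∀ g h → σ (g ⊕ h) ≡ σ g ⊕ σ h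

  hom-e : ∀ {σ} → IsHom σ → σ e ≡ e
  hom-e {σ} hom = ∙-cancelˡ (σ e) (σ e) e (begin
    σ e ⊕ σ e     ≡⟨ hom e e ⟨
    σ (e ⊕ e)     ≡⟨ cong σ (identityˡ e) ⟩
    σ e           ≡⟨ identityʳ (σ e) ⟨
    σ e ⊕ e       ∎)

  hom-diff : ∀ {σ} → IsHom σ → ∀ g h → σ h - σ g ≡ σ (h - g)
  hom-diff {σ} hom g h = begin
    σ h - σ g                  ≡⟨ cong (λ x → σ x - σ g) (//-rightDividesˡ g h) ⟨
    σ ((h - g) ⊕ g) - σ g      ≡⟨ cong (_- σ g) (hom (h - g) g) ⟩
    (σ (h - g) ⊕ σ g) - σ g    ≡⟨ //-rightDividesʳ (σ g) (σ (h - g)) ⟩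
    σ (h - g)                  ∎

  hom-· : ∀ {σ} → IsHom σ → ∀ k g → σ (k · g) ≡ k · σ g
  hom-· hom zero    g = hom-e hom
  hom-· hom (suc k) g = trans (hom g (k · g)) (cong (_ ⊕_) (hom-· hom k g))

  autG-id : IsAutG (λ g → g)
  autG-id = bijective _ _ (λ _ → refl) (λ _ → refl) , (λ _ _ → refl)

  autG-ext : ∀ {σ τ} → IsAutG σ → (∀ g → σ g ≡ τ g) → IsAutG τ
  autG-ext {σ} {τ} (bij , hom) σ≗τ =
    bijective τ (inverse σ bij)
      (λ g → trans (cong (inverse σ bij) (sym (σ≗τ g))) (inverse-left σ bij g))
      (λ g → trans (sym (σ≗τ _)) (inverse-right σ bij g)) ,
    λ g h → trans (sym (σ≗τ (g ⊕ h))) (trans (hom g h) (cong₂ _⊕_ (σ≗τ g) (σ≗τ h)))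

  autG-∘ : ∀ {σ τ} → IsAutG σ → IsAutG τ → IsAutG (λ g → σ (τ g))
  autG-∘ {σ} {τ} (bij-σ , hom-σ) (bij-τ , hom-τ) =
    bijective _ (λ g → inverse τ bij-τ (inverse σ bij-σ g))
      (λ g → trans (cong (inverse τ bij-τ) (inverse-left σ bij-σ (τ g))) (inverse-left τ bij-τ g))
      (λ g → trans (cong σ (inverse-right τ bij-τ _)) (inverse-right σ bij-σ g)) ,
    λ g h → trans (cong σ (hom-τ g h)) (hom-σ (τ g) (τ h))

  autG-inverse : ∀ {σ} (aut : IsAutG σ) → IsAutG (inverse σ (proj₁ aut))
  autG-inverse {σ} (bij , hom) =
    bijective σ⁻¹ σ (inverse-right σ bij) (inverse-left σ bij) ,
    λ g h → proj₁ bij (begin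
      σ (σ⁻¹ (g ⊕ h))           ≡⟨ inverse-right σ bij (g ⊕ h) ⟩
      g ⊕ h                     ≡⟨ cong₂ _⊕_ (inverse-right σ bij g) (inverse-right σ bij h) ⟨
      σ (σ⁻¹ g) ⊕ σ (σ⁻¹ h)     ≡⟨ hom (σ⁻¹ g) (σ⁻¹ h) ⟨
      σ (σ⁻¹ g ⊕ σ⁻¹ h)         ∎)
    where
    σ⁻¹ = inverse σ bij

module CountingG (p : ℕ) .{{_ : NonZero p}} (n : ℕ) where

  open import Data.Fin using (Fin)
  open import Data.Vec using (Vec; []; _∷_)
  open import Data.List using ([]; _∷_; _++_; map; length; concatMap; cartesianProductWith; allFin)
  open import Data.List.Properties using (length-++; length-map; length-tabulate)
  open import Data.List.Relation.Unary.Any using (here)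
  import Data.List.Relation.Unary.Unique.Propositional.Properties as Unique
  import Data.List.Membership.Propositional.Properties as ∈
  import Data.List.Relation.Unary.All as All
  import Data.List.Relation.Unary.AllPairs as AllPairs
  open import Relation.Binary.PropositionalEquality
  open Defs.EA p n using (G; allVec; allG; count; _⊕_)
  open GroupG p n using (_-_; ∙-cancelʳ; //-rightDividesˡ)

  cons : ∀ {m} → Fin p → Vec (Fin p) m → Vec (Fin p) (suc m)
  cons = _∷_

  allVec-as-product : ∀ {m} as (ys : List (Vec (Fin p) m)) →
                      concatMap (λ a → map (cons a) ys) as ≡ cartesianProductWith cons as ys
  allVec-as-product [] ys = refl
  allVec-as-product (a ∷ as) ys = cong (map (cons a) ys ++_) (allVec-as-product as ys)

  ∷-injective : ∀ {m} {a b : Fin p} {v w : Vec (Fin p) m} → a ∷ v ≡ b ∷ w → a ≡ b × v ≡ w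
  ∷-injective refl = refl , refl

  allVec-unique : ∀ m → Unique (allVec m)
  allVec-unique zero = All.[] AllPairs.∷ AllPairs.[]
  allVec-unique (suc m) = subst Unique (sym (allVec-as-product (allFin p) (allVec m)))
    (Unique.cartesianProductWith⁺ cons ∷-injective (Unique.allFin⁺ p) (allVec-unique m))

  allVec-complete : ∀ m (v : Vec (Fin p) m) → v ∈ allVec m
  allVec-complete zero [] = here refl
  allVec-complete (suc m) (a ∷ v) = subst ((a ∷ v) ∈_) (sym (allVec-as-product (allFin p) (allVec m)))
    (∈.∈-cartesianProductWith⁺ cons (∈.∈-allFin a) (allVec-complete m v))

  length-product : ∀ {m} as (ys : List (Vec (Fin p) m)) →
                   length (cartesianProductWith cons as ys) ≡ length as * length ys
  length-product [] ys = refl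
  length-product (a ∷ as) ys = trans (length-++ (map (cons a) ys))
    (cong₂ _+_ (length-map (cons a) ys) (length-product as ys))

  allVec-length : ∀ m → length (allVec m) ≡ p ^ m
  allVec-length zero = refl
  allVec-length (suc m) = begin
    length (allVec (suc m))                                    ≡⟨ cong length (allVec-as-product (allFin p) (allVec m)) ⟩
    length (cartesianProductWith cons (allFin p) (allVec m))    ≡⟨ length-product (allFin p) (allVec m) ⟩
    length (allFin p) * length (allVec m)                      ≡⟨ cong₂ _*_ (length-tabulate {n = p} (λ i → i)) (allVec-length m) ⟩
    p * p ^ m                                                  ∎
    where open ≡-Reasoning

  open Counting allG (allVec-unique n) (allVec-complete n) public hiding (count)

  count-shift : ∀ P t → count (λ g → P (g ⊕ t)) ≡ count P
  count-shift P t = count-bij P (_⊕ t) (λ {x} {y} → ∙-cancelʳ t x y) (λ y → y - t , //-rightDividesˡ t y)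

-- The central one: translation by an
-- element t of the thin radical maps basic sets onto basic sets, because
-- the coefficient of z in X̲·{t} is 1 or 0 according as z - t ∈ X or not.
module SRing (p : ℕ) .{{_ : NonZero p}} (n : ℕ) (lab : Defs.EA.G p n → ℕ) (S : Defs.EA.IsSRing p n lab) where

  open import Data.Bool using (T; not)
  open import Data.Bool.Properties using (T-≡)
  import Data.Bool as Bool
  open import Data.Nat.Properties using (≡⇒≡ᵇ; ≡ᵇ⇒≡; n≮n)
  open import Data.Unit using (tt)
  import Data.List.Relation.Unary.All as All
  open import Data.List.Relation.Unary.All.Properties using (all⁺; all⁻)
  open import Relation.Binary.PropositionalEquality
  open import Relation.Nullary using (¬_; Dec; yes; no)
  open import Relation.Nullary.Decidable using (⌊_⌋; fromWitness)
  open Defs.EA p n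
  open GroupG p n
  open CountingG p n using (count-pos; count-witness; allVec-complete)
  open IsSRing S
  open Equivalence

  Thin : G → Set
  Thin = InOθ lab

  thin? : ∀ g → Dec (Thin g)
  thin? g = thinᵇ lab g Bool.≟ true

  same⇔ : ∀ g h → same lab g h ≡ true ⇔ lab g ≡ lab h
  same⇔ g h = mk⇔ (λ s → ≡ᵇ⇒≡ _ _ (from T-≡ s)) (λ eq → to T-≡ (≡⇒≡ᵇ _ _ eq))

  thin-singleton : ∀ {t} → Thin t → ∀ h → lab h ≡ lab t → h ≡ t
  thin-singleton {t} thin h h~t = decide (h ≟G t)
    (All.lookup (all⁺ _ allG (from T-≡ thin)) (allVec-complete n h))
    where
    decide : (d : Dec (h ≡ t)) → T (not (same lab h t) ∨ ⌊ d ⌋) → h ≡ t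
    decide (yes h≡t) _ = h≡t
    decide (no _) test = ⊥-elim (subst (λ b → T (not b ∨ false)) (from (same⇔ h t) h~t) test)

  singleton-thin : ∀ {t} → (∀ h → lab h ≡ lab t → h ≡ t) → Thin t
  singleton-thin {t} singleton = to T-≡ (all⁻ _ {xs = allG} (All.tabulate λ {h} _ → test h))
    where
    test : ∀ h → T (not (same lab h t) ∨ ⌊ h ≟G t ⌋)
    test h with same lab h t in s
    ... | false = tt
    ... | true  = fromWitness (singleton h (to (same⇔ h t) s))

  structConst-test⇔ : ∀ x y z b →
    (same lab (z - b) x ∧ same lab b y) ≡ true ⇔ (lab (z - b) ≡ lab x × lab b ≡ lab y)
  structConst-test⇔ x y z b = mk⇔
    (λ s → let (s₁ , s₂) = to ∧⇔ s in to (same⇔ _ x) s₁ , to (same⇔ b y) s₂)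
    (λ (e₁ , e₂) → from ∧⇔ (from (same⇔ _ x) e₁ , from (same⇔ b y) e₂))

  product-support : ∀ x y z z' b → lab z ≡ lab z' → lab (z - b) ≡ lab x → lab b ≡ lab y →
                    ∃[ b' ] (lab (z' - b') ≡ lab x × lab b' ≡ lab y)
  product-support x y z z' b z~z' z-b∈X b∈Y =
    let (b' , test) = count-witness _ positive in b' , to (structConst-test⇔ x y z' b') test
    where
    positive : ¬ structConst lab x y z' ≡ 0
    positive c≡0 = n≮n 0 (subst (0 <_) (trans (mult-closed x y z z' z~z') c≡0)
                     (count-pos _ b (from (structConst-test⇔ x y z b) (z-b∈X , b∈Y))))

  translate⁻ : ∀ {t} → Thin t → ∀ z z' → lab z ≡ lab z' → lab (z - t) ≡ lab (z' - t)
  translate⁻ {t} thin z z' z~z' =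
    let (b , z'-b~z-t , b~t) = product-support (z - t) t z z' t z~z' refl refl
    in sym (subst (λ b → lab (z' - b) ≡ lab (z - t)) (thin-singleton thin b b~t) z'-b~z-t)

  ⊖-thin : ∀ {t} → Thin t → Thin (⊖ t)
  ⊖-thin {t} thin = singleton-thin λ h h~⊖t → begin
    h         ≡⟨ ⁻¹-involutive h ⟨
    ⊖ (⊖ h)   ≡⟨ cong ⊖_ (thin-singleton thin (⊖ h)
                   (trans (inverse-closed h (⊖ t) h~⊖t) (cong lab (⁻¹-involutive t)))) ⟩
    ⊖ t       ∎
    where open ≡-Reasoning

  translate : ∀ {t} → Thin t → ∀ z z' → lab z ≡ lab z' → lab (z ⊕ t) ≡ lab (z' ⊕ t)
  translate {t} thin z z' z~z' = subst (λ s → lab (z ⊕ s) ≡ lab (z' ⊕ s)) (⁻¹-involutive t)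
    (translate⁻ (⊖-thin thin) z z' z~z')

  untranslate : ∀ {t} → Thin t → ∀ z z' → lab (z ⊕ t) ≡ lab (z' ⊕ t) → lab z ≡ lab z'
  untranslate {t} thin z z' z+t~z'+t = subst₂ (λ a b → lab a ≡ lab b)
    (//-rightDividesʳ t z) (//-rightDividesʳ t z') (translate⁻ thin _ _ z+t~z'+t)

  e-thin : Thin e
  e-thin = singleton-thin identity-basic

  ⊕-thin : ∀ {g h} → Thin g → Thin h → Thin (g ⊕ h)
  ⊕-thin {g} {h} thin-g thin-h = singleton-thin λ y y~g+h → begin
    y             ≡⟨ //-rightDividesˡ h y ⟨
    (y - h) ⊕ h   ≡⟨ cong (_⊕ h) (thin-singleton thin-g (y - h)
                       (trans (translate⁻ thin-h y (g ⊕ h) y~g+h) (cong lab (//-rightDividesʳ h g)))) ⟩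
    g ⊕ h         ∎
    where open ≡-Reasoning

  -‿thin : ∀ {g h} → Thin g → Thin h → Thin (g - h)
  -‿thin thin-g thin-h = ⊕-thin thin-g (⊖-thin thin-h)

  ·-thin : ∀ k {g} → Thin g → Thin (k · g)
  ·-thin zero    thin = e-thin
  ·-thin (suc k) thin = ⊕-thin thin (·-thin k thin)

  thin-of-multiple : Prime p → ∀ j {g} → 0 < j → j < p → Thin (j · g) → Thin g
  thin-of-multiple p-prime j {g} 0<j j<p thin =
    let (m , m*j·≡id) = residue-inverse p-prime j 0<j j<p
    in subst Thin (trans (×-assocˡ g m j) (m*j·≡id g)) (·-thin m thin)

module IndexP (p : ℕ) .{{_ : NonZero p}} (p-prime : Prime p) (n : ℕ)
              (lab : Defs.EA.G p n → ℕ) (PS : Defs.EA.IsPSRing p n lab)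
              (index-p : Defs.EA.count p n (Defs.EA.thinᵇ p n lab) * p ≡ p ^ n) where

  import Data.Bool as Bool
  open import Data.Bool.Properties using (T-≡)
  open import Data.List.Relation.Unary.Any using (any?; satisfied) renaming (map to any-map)
  open import Data.Nat using (_∸_; _%_; z<s; nonTrivial⇒n>1; _≟_)
  open import Data.Nat.DivMod using (m%n<n)
  open import Data.Nat.Primality using (prime⇒nonTrivial)
  open import Data.Nat.Properties
  open import Function.Definitions using (Bijective)
  open import Relation.Binary.Definitions using (tri<; tri≈; tri>)
  open import Relation.Binary.PropositionalEquality
  open import Relation.Nullary using (¬_; yes; no)
  open Defs.EA p n
  open GroupG p n
  open CountingG p n
  open AutomorphismsG p n
  open SRing p n lab (proj₁ PS) public
  open Equivalence

  module Cosets where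

    1<p : 1 < p
    1<p = nonTrivial⇒n>1 p {{prime⇒nonTrivial p-prime}}

    -- O_θ ≠ G, since |O_θ| · p = |G|
    non-thin-exists : ∃[ c ] ¬ Thin c
    non-thin-exists with any? (λ g → thinᵇ lab g Bool.≟ false) allG
    ... | yes some = let (c , c-fails) = satisfied some in c , λ thin → true≢false (trans (sym thin) c-fails)
      where
      true≢false : ¬ true ≡ false
      true≢false ()
    ... | no none = ⊥-elim (<-irrefl (sym pⁿ*p≡pⁿ) (m<m*n (p ^ n) p 1<p))
      where
      instance
        pⁿ≢0 : NonZero (p ^ n)
        pⁿ≢0 = m^n≢0 p n
      all-thin : ∀ g → thinᵇ lab g ≡ true
      all-thin g with thinᵇ lab g in g-test
      ... | true  = refl
      ... | false = ⊥-elim (none (any-map (λ { refl → g-test }) (allVec-complete n g)))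
      pⁿ*p≡pⁿ : p ^ n * p ≡ p ^ n
      pⁿ*p≡pⁿ = trans (cong (_* p) (sym (trans (count-all _ all-thin) (allVec-length n)))) index-p

    c : G
    c = proj₁ non-thin-exists

    c-non-thin : ¬ Thin c
    c-non-thin = proj₂ non-thin-exists

    -- distinct cosets O_θ + k·c, O_θ + m·c are disjoint: otherwise (m - k)·c,
    -- and so c, would be thin
    cosets-disjoint : ∀ {k m} g → k < m → m < p → Thin (g - k · c) → Thin (g - m · c) → ⊥
    cosets-disjoint {k} {m} g k<m m<p in-k in-m = c-non-thin
      (thin-of-multiple p-prime (m ∸ k) (m<n⇒0<n∸m k<m) (≤-<-trans (m∸n≤m m k) m<p)
        (subst Thin (trans (diff-diff g (k · c) (m · c)) (·-∸ m k c (<⇒≤ k<m))) (-‿thin in-k in-m)))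

    -- opaque: only the statement is used later, and unfolding the counting
    -- proof during type checking is very costly
    opaque
      cosets-cover : ∀ g → ∃[ k ] (k < p × Thin (g - k · c))
      cosets-cover = count-cover (λ k g → thinᵇ lab (g - k · c)) p (count (thinᵇ lab))
        cosets-disjoint (λ k → count-shift (thinᵇ lab) (⊖ (k · c)))
        (trans (*-comm p _) (trans index-p (sym (allVec-length n))))

    idx : G → ℕ
    idx g = proj₁ (cosets-cover g)

    idx<p : ∀ g → idx g < p
    idx<p g = proj₁ (proj₂ (cosets-cover g))

    idx-spec : ∀ g → Thin (g - idx g · c)
    idx-spec g = proj₂ (proj₂ (cosets-cover g))

    decompose : ∀ g → idx g · c ⊕ (g - idx g · c) ≡ g
    decompose g = add-diff g (idx g · c)

    idx-unique : ∀ g k → k < p → Thin (g - k · c) → idx g ≡ k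
    idx-unique g k k<p in-k with <-cmp (idx g) k
    ... | tri≈ _ idx≡k _ = idx≡k
    ... | tri< idx<k _ _ = ⊥-elim (cosets-disjoint g idx<k k<p (idx-spec g) in-k)
    ... | tri> _ _ k<idx = ⊥-elim (cosets-disjoint g k<idx (idx<p g) in-k (idx-spec g))

    thin⇔idx≡0 : ∀ g → Thin g ⇔ idx g ≡ 0
    thin⇔idx≡0 g = mk⇔
      (λ thin → idx-unique g 0 (<-trans z<s 1<p) (subst Thin (sym (diff-e g)) thin))
      (λ idx≡0 → subst Thin (trans (cong (λ k → g - k · c) idx≡0) (diff-e g)) (idx-spec g))

    idx-⊕ : ∀ g h → idx (g ⊕ h) ≡ (idx g + idx h) % p
    idx-⊕ g h = idx-unique (g ⊕ h) _ (m%n<n _ p) (subst Thin components (⊕-thin (idx-spec g) (idx-spec h)))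
      where
      open ≡-Reasoning
      components : (g - idx g · c) ⊕ (h - idx h · c) ≡ (g ⊕ h) - ((idx g + idx h) % p) · c
      components = begin
        (g - idx g · c) ⊕ (h - idx h · c)      ≡⟨ diff-⊕ g h (idx g · c) (idx h · c) ⟨
        (g ⊕ h) - (idx g · c ⊕ idx h · c)      ≡⟨ cong ((g ⊕ h) -_) (×-homo-+ c (idx g) (idx h)) ⟨
        (g ⊕ h) - (idx g + idx h) · c          ≡⟨ cong ((g ⊕ h) -_) (·-mod (idx g + idx h) c) ⟨
        (g ⊕ h) - ((idx g + idx h) % p) · c    ∎

    idx-translate : ∀ g {t} → Thin t → idx (g ⊕ t) ≡ idx g
    idx-translate g {t} thin = idx-unique (g ⊕ t) (idx g) (idx<p g)
      (subst Thin (xy∙z≈xz∙y g (⊖ (idx g · c)) t) (⊕-thin (idx-spec g) thin))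

    same-coset⇔ : ∀ g h → Thin (g - h) ⇔ idx g ≡ idx h
    same-coset⇔ g h = mk⇔
      (λ thin → trans (cong idx (sym (add-diff g h))) (idx-translate h thin))
      (λ idx≡ → subst Thin (trans (cong (λ k → (g - k · c) - (h - idx h · c)) idx≡)
                                  (diff-translate g h (⊖ (idx h · c))))
                           (-‿thin (idx-spec g) (idx-spec h)))

    idx-· : ∀ a b x → idx (a ⊕ b) · x ≡ idx a · x ⊕ idx b · x
    idx-· a b x = begin
      idx (a ⊕ b) · x              ≡⟨ cong (_· x) (idx-⊕ a b) ⟩
      ((idx a + idx b) % p) · x    ≡⟨ ·-mod (idx a + idx b) x ⟩
      (idx a + idx b) · x          ≡⟨ ×-homo-+ x (idx a) (idx b) ⟩
      idx a · x ⊕ idx b · x        ∎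
      where open ≡-Reasoning

    idx-pos : ∀ {g} → ¬ Thin g → 0 < idx g
    idx-pos {g} non-thin with idx g in idx≡
    ... | zero  = ⊥-elim (non-thin (from (thin⇔idx≡0 g) idx≡))
    ... | suc _ = z<s

  open Cosets public

  module BasicSetsInCosets where

    -- h ∈ R(x) = O_θ ∩ rad(X) for X the basic set of x: h thin with x + h ∈ X
    ThinStab : G → G → Set
    ThinStab x h = Thin h × lab (x ⊕ h) ≡ lab x

    thinStab? : G → G → Bool
    thinStab? x h = thinᵇ lab h ∧ same lab (x ⊕ h) x

    thinStab?⇔ : ∀ x h → thinStab? x h ≡ true ⇔ ThinStab x h
    thinStab?⇔ x h = mk⇔ (λ r → let (r₁ , r₂) = to ∧⇔ r in r₁ , to (same⇔ _ x) r₂)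
                        (λ (thin , x+h~x) → from ∧⇔ (thin , from (same⇔ _ x) x+h~x))

    -- For non-thin x ∈ X the
    -- slices X ∩ (O_θ + j·c) are empty or translates of R(x), the slice j = 0
    -- is empty, and |X| is a power of p; EqualParts leaves one nonempty slice.
    module Slices {x : G} (x-non-thin : ¬ Thin x) where


      slice : ℕ → G → Bool
      slice j g = same lab g x ∧ (idx g ≡ᵇ j)

      slice⇔ : ∀ j g → slice j g ≡ true ⇔ (lab g ≡ lab x × idx g ≡ j)
      slice⇔ j g = mk⇔
        (λ s → let (s₁ , s₂) = to ∧⇔ s in to (same⇔ g x) s₁ , ≡ᵇ⇒≡ _ _ (from T-≡ s₂))
        (λ (g~x , idx≡j) → from ∧⇔ (from (same⇔ g x) g~x , to T-≡ (≡⇒≡ᵇ _ _ idx≡j)))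

      slice-translate : ∀ {j y} → slice j y ≡ true → ∀ g → slice j g ≡ thinStab? x (g - y)
      slice-translate {j} {y} y∈slice g = bool-ext (mk⇔
        (λ g∈slice → let (g~x , idx-g) = to (slice⇔ j g) g∈slice
                         thin = from (same-coset⇔ g y) (trans idx-g (sym idx-y))
                     in from (thinStab?⇔ x (g - y)) (thin , (begin
                       lab (x ⊕ (g - y))   ≡⟨ translate thin x y (sym y~x) ⟩
                       lab (y ⊕ (g - y))   ≡⟨ cong lab (add-diff g y) ⟩
                       lab g               ≡⟨ g~x ⟩
                       lab x               ∎)))
        (λ g-y∈R → let (thin , x+[g-y]~x) = to (thinStab?⇔ x (g - y)) g-y∈R
                   in from (slice⇔ j g) ((begin
                       lab g               ≡⟨ cong lab (add-diff g y) ⟨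
                       lab (y ⊕ (g - y))   ≡⟨ translate thin y x y~x ⟩
                       lab (x ⊕ (g - y))   ≡⟨ x+[g-y]~x ⟩
                       lab x               ∎) ,
                     trans (to (same-coset⇔ g y) thin) idx-y)))
        where
        open ≡-Reasoning
        y~x = proj₁ (to (slice⇔ j y) y∈slice)
        idx-y = proj₂ (to (slice⇔ j y) y∈slice)

      slice-size : ∀ j → count (slice j) ≡ 0 ⊎ count (slice j) ≡ count (thinStab? x)
      slice-size j with count (slice j) ≟ 0
      ... | yes empty = inj₁ empty
      ... | no nonempty = let (y , y∈slice) = count-witness (slice j) nonempty in
        inj₂ (trans (count-ext _ _ (slice-translate y∈slice)) (count-shift (thinStab? x) (⊖ y)))

      -- the slice in O_θ is empty, as thin elements form singleton basic sets
      slice₀-empty : count (slice 0) ≡ 0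
      slice₀-empty = count-none (slice 0) not-in-slice₀
        where
        not-in-slice₀ : ∀ g → slice 0 g ≡ false
        not-in-slice₀ g with slice 0 g in g∈slice
        ... | false = refl
        ... | true  = let (g~x , idx≡0) = to (slice⇔ 0 g) g∈slice
                          thin = from (thin⇔idx≡0 g) idx≡0
                      in ⊥-elim (x-non-thin (subst Thin (sym (thin-singleton thin x (sym g~x))) thin))

      nonempty-slice : ∀ y → lab y ≡ lab x → ¬ count (slice (idx y)) ≡ 0
      nonempty-slice y y~x empty = <-irrefl (sym empty)
        (count-pos (slice (idx y)) y (from (slice⇔ (idx y) y) (y~x , refl)))

      same-coset-as-x : ∀ y → lab y ≡ lab x → idx y ≡ idx x
      same-coset-as-x y y~x =
        let (k , |X|≡pᵏ) = proj₂ PS x in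
        EqualParts.at-most-one-nonzero p-prime (λ j → count (slice j)) (count (thinStab? x)) slice-size
          slice₀-empty k (trans (sym (count-split _ idx p idx<p)) |X|≡pᵏ)
          (idx<p y) (idx<p x) (nonempty-slice y y~x) (nonempty-slice x refl)

    basic-set-in-coset : ∀ x y → lab y ≡ lab x → Thin (y - x)
    basic-set-in-coset x y y~x with thin? x
    ... | yes thin = subst Thin (sym (trans (cong (_- x) (thin-singleton thin y y~x)) (inverseʳ x))) e-thin
    ... | no non-thin = from (same-coset⇔ y x) (Slices.same-coset-as-x non-thin y y~x)

  open BasicSetsInCosets public

  module Stabilisers where

    stab-e : ∀ x → ThinStab x e
    stab-e x = e-thin , cong lab (identityʳ x)

    stab-⊕ : ∀ {x h₁ h₂} → ThinStab x h₁ → ThinStab x h₂ → ThinStab x (h₁ ⊕ h₂)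
    stab-⊕ {x} {h₁} {h₂} (thin₁ , x+h₁~x) (thin₂ , x+h₂~x) = ⊕-thin thin₁ thin₂ , (begin
      lab (x ⊕ (h₁ ⊕ h₂))   ≡⟨ cong lab (assoc x h₁ h₂) ⟨
      lab ((x ⊕ h₁) ⊕ h₂)   ≡⟨ translate thin₂ _ _ x+h₁~x ⟩
      lab (x ⊕ h₂)          ≡⟨ x+h₂~x ⟩
      lab x                 ∎)
      where open ≡-Reasoning

    stab-⊖ : ∀ {x h} → ThinStab x h → ThinStab x (⊖ h)
    stab-⊖ {x} {h} (thin , x+h~x) = ⊖-thin thin ,
      sym (trans (cong lab (sym (//-rightDividesʳ h x))) (translate⁻ thin _ _ x+h~x))

    stab-· : ∀ {x} k {h} → ThinStab x h → ThinStab x (k · h)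
    stab-· {x} zero    _    = stab-e x
    stab-· (suc k) stab = stab-⊕ stab (stab-· k stab)

    stab-translate : ∀ {x t h} → Thin t → ThinStab x h → ThinStab (x ⊕ t) h
    stab-translate {x} {t} {h} thin-t (thin , x+h~x) = thin , (begin
      lab ((x ⊕ t) ⊕ h)   ≡⟨ cong lab (xy∙z≈xz∙y x t h) ⟩
      lab ((x ⊕ h) ⊕ t)   ≡⟨ translate thin-t _ _ x+h~x ⟩
      lab (x ⊕ t)         ∎)
      where open ≡-Reasoning

    stab-untranslate : ∀ {x t h} → Thin t → ThinStab (x ⊕ t) h → ThinStab x h
    stab-untranslate {x} {t} {h} thin-t (thin , x+t+h~x+t) =
      thin , untranslate thin-t _ _ (trans (cong lab (xy∙z≈xz∙y x h t)) x+t+h~x+t)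

    -- ... and R(x + y) ⊆ R(x) + R(y): the support of X̲·Y̲ is a union of basic
    -- sets, and X, Y lie in cosets of O_θ
    stab-sum : ∀ x y {h} → ThinStab (x ⊕ y) h →
               ∃[ h₁ ] ∃[ h₂ ] (ThinStab x h₁ × ThinStab y h₂ × h ≡ h₁ ⊕ h₂)
    stab-sum x y {h} (thin , x+y+h~x+y) =
      let (b , z-b~x , b~y) = product-support x y (x ⊕ y) z y
                                (sym x+y+h~x+y) (cong lab (//-rightDividesʳ y x)) refl
          h₁ = (z - b) - x
          h₂ = b - y
      in h₁ , h₂ ,
         (basic-set-in-coset x (z - b) z-b~x , trans (cong lab (add-diff (z - b) x)) z-b~x) ,
         (basic-set-in-coset y b b~y , trans (cong lab (add-diff b y)) b~y) ,
         ∙-cancelˡ (x ⊕ y) h (h₁ ⊕ h₂) (sym (begin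
           (x ⊕ y) ⊕ (h₁ ⊕ h₂)       ≡⟨ interchange x y h₁ h₂ ⟩
           (x ⊕ h₁) ⊕ (y ⊕ h₂)       ≡⟨ cong₂ _⊕_ (add-diff (z - b) x) (add-diff b y) ⟩
           (z - b) ⊕ b               ≡⟨ //-rightDividesˡ b z ⟩
           z                         ∎))
      where
      open ≡-Reasoning
      z = (x ⊕ y) ⊕ h

    stab-multiple : ∀ k g {h} → ¬ Thin (k · g) → ThinStab (k · g) h → ThinStab g h
    stab-multiple zero    g non-thin _ = ⊥-elim (non-thin e-thin)
    stab-multiple (suc k) g {h} _ stab with thin? (k · g)
    ... | yes thin-kg = stab-untranslate thin-kg stab
    ... | no non-thin-kg = let (h₁ , h₂ , stab₁ , stab₂ , h≡h₁+h₂) = stab-sum g (k · g) stab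
                           in subst (ThinStab g) (sym h≡h₁+h₂)
                                (stab-⊕ stab₁ (stab-multiple k g non-thin-kg stab₂))

    -- R(x) = R(c) for every non-thin x: writing x = k·c + t with t thin and
    -- m·k ≡ 1 (mod p), R(x) = R(k·c) ⊆ R(c) = R(m·(k·c)) ⊆ R(k·c)
    stab-independent : ∀ {x h} → ¬ Thin x → ThinStab x h ⇔ ThinStab c h
    stab-independent {x} {h} non-thin = mk⇔ to-c from-c
      where
      k = idx x
      t = x - k · c
      x≡kc+t : k · c ⊕ t ≡ x
      x≡kc+t = decompose x
      non-thin-kc : ¬ Thin (k · c)
      non-thin-kc thin = non-thin (subst Thin x≡kc+t (⊕-thin thin (idx-spec x)))
      to-c : ThinStab x h → ThinStab c h
      to-c stab = stab-multiple k c non-thin-kc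
        (stab-untranslate (idx-spec x) (subst (λ y → ThinStab y h) (sym x≡kc+t) stab))
      from-c : ThinStab c h → ThinStab x h
      from-c stab =
        let (m , m*k·≡id) = residue-inverse p-prime k (idx-pos non-thin) (idx<p x)
            m·kc≡c = trans (×-assocˡ c m k) (m*k·≡id c)
        in subst (λ y → ThinStab y h) x≡kc+t (stab-translate (idx-spec x)
             (stab-multiple m (k · c) (λ thin → c-non-thin (subst Thin m·kc≡c thin))
               (subst (λ y → ThinStab y h) (sym m·kc≡c) stab)))

    L : G → Set
    L = ThinStab c

    class-is-coset : ∀ x y → lab y ≡ lab x → L (y - x)
    class-is-coset x y y~x with thin? x
    ... | yes thin = subst L (sym (trans (cong (_- x) (thin-singleton thin y y~x)) (inverseʳ x))) (stab-e c)
    ... | no non-thin = to (stab-independent non-thin)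
                          (basic-set-in-coset x y y~x , trans (cong lab (add-diff y x)) y~x)

    L-is-A-subgroup : IsASubgroup lab L
    L-is-A-subgroup =
      record { has-e = stab-e c ; ⊕-closed = λ _ _ → stab-⊕ ; ⊖-closed = λ _ → stab-⊖ } ,
      λ g h g~h L-g → subst L (sym (thin-singleton (proj₁ L-g) h (sym g~h))) L-g

    L-stabilises : ∀ {y l} → ¬ Thin y → L l → lab (l ⊕ y) ≡ lab y
    L-stabilises {y} {l} non-thin L-l =
      trans (cong lab (comm l y)) (proj₂ (from (stab-independent non-thin) L-l))

    L-wreath : IsWreath lab (InOθ lab) L
    L-wreath x (y , y~x , non-thin-y) l L-l z = z~x⇒l+z~x , l+z~x⇒z~x
      where
      non-thin-class : ∀ {w} → lab w ≡ lab x → ¬ Thin w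
      non-thin-class w~x thin =
        non-thin-y (subst Thin (sym (thin-singleton thin y (trans y~x (sym w~x)))) thin)
      z~x⇒l+z~x : lab z ≡ lab x → lab (l ⊕ z) ≡ lab x
      z~x⇒l+z~x z~x = trans (L-stabilises (non-thin-class z~x) L-l) z~x
      l+z~x⇒z~x : lab (l ⊕ z) ≡ lab x → lab z ≡ lab x
      l+z~x⇒z~x l+z~x = trans (cong lab (sym (\\-leftDividesʳ l z)))
        (trans (L-stabilises (non-thin-class l+z~x) (stab-⊖ L-l)) l+z~x)

  open Stabilisers public

  module Cyclotomy where

    fixes-basic-sets : ∀ {σ} → AutGA lab σ → ∀ g → lab (σ g) ≡ lab g
    fixes-basic-sets {σ} ((_ , preserves) , (_ , hom)) g =
      subst₂ (λ a b → lab a ≡ lab b) (trans (cong (σ g -_) (hom-e hom)) (diff-e (σ g))) (diff-e g)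
        (preserves e g)

    fixing-basic-sets : ∀ {σ} → IsAutG σ → (∀ g → lab (σ g) ≡ lab g) → AutGA lab σ
    fixing-basic-sets aut@(bij , hom) fixes =
      (bij , λ g h → trans (cong lab (hom-diff hom g h)) (fixes (h - g))) , aut

    aut-fixes-thin : ∀ {σ t} → AutGA lab σ → Thin t → σ t ≡ t
    aut-fixes-thin {σ} {t} aut thin = thin-singleton thin (σ t) (fixes-basic-sets aut t)

    -- an element of Aut_G(A) is determined by its value at c, since it
    -- fixes O_θ pointwise and G = O_θ + ⟨c⟩
    aut-determined : ∀ {σ τ} → AutGA lab σ → AutGA lab τ → σ c ≡ τ c → ∀ g → σ g ≡ τ g
    aut-determined {σ} {τ} aut-σ aut-τ σc≡τc g = begin
      σ g                     ≡⟨ cong σ (decompose g) ⟨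
      σ (k · c ⊕ t)           ≡⟨ on-components aut-σ ⟩
      k · σ c ⊕ t             ≡⟨ cong (λ x → k · x ⊕ t) σc≡τc ⟩
      k · τ c ⊕ t             ≡⟨ on-components aut-τ ⟨
      τ (k · c ⊕ t)           ≡⟨ cong τ (decompose g) ⟩
      τ g                     ∎
      where
      open ≡-Reasoning
      k = idx g
      t = g - idx g · c
      on-components : ∀ {ρ} → AutGA lab ρ → ρ (k · c ⊕ t) ≡ k · ρ c ⊕ t
      on-components {ρ} aut@(_ , (_ , hom)) =
        trans (hom (k · c) t) (cong₂ _⊕_ (hom-· hom k c) (aut-fixes-thin aut (idx-spec g)))

    aut-subgroup : IsAutSubgroup (AutGA lab)
    aut-subgroup = record
      { auts        = λ _ → proj₂
      ; extensional = λ σ τ aut σ≗τ → fixing-basic-sets (autG-ext (proj₂ aut) σ≗τ)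
                        (λ g → trans (cong lab (sym (σ≗τ g))) (fixes-basic-sets aut g))
      ; has-id      = fixing-basic-sets autG-id (λ _ → refl)
      ; ∘-closed    = λ σ τ aut-σ aut-τ → fixing-basic-sets (autG-∘ (proj₂ aut-σ) (proj₂ aut-τ))
                        (λ g → trans (fixes-basic-sets aut-σ (τ g)) (fixes-basic-sets aut-τ g))
      ; inv-closed  = λ σ aut → let bij = proj₁ (proj₂ aut) in
                        Bijections.inverse σ bij ,
                        fixing-basic-sets (autG-inverse (proj₂ aut))
                          (λ g → trans (sym (fixes-basic-sets aut _)) (cong lab (Bijections.inverse-right σ bij g))) ,
                        Bijections.inverse-left σ bij }

    shear : G → G → G
    shear l g = g ⊕ idx g · l

    shear-hom : ∀ l → IsHom (shear l)
    shear-hom l a b = begin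
      (a ⊕ b) ⊕ idx (a ⊕ b) · l                 ≡⟨ cong ((a ⊕ b) ⊕_) (idx-· a b l) ⟩
      (a ⊕ b) ⊕ (idx a · l ⊕ idx b · l)         ≡⟨ interchange a b _ _ ⟩
      (a ⊕ idx a · l) ⊕ (b ⊕ idx b · l)         ∎
      where open ≡-Reasoning

    shear-inverse : ∀ {l} → Thin l → ∀ g → shear (⊖ l) (shear l g) ≡ g
    shear-inverse {l} thin g = begin
      shear l g ⊕ idx (shear l g) · (⊖ l)     ≡⟨ cong (λ k → shear l g ⊕ k · (⊖ l)) (idx-translate g (·-thin (idx g) thin)) ⟩
      (g ⊕ idx g · l) ⊕ idx g · (⊖ l)         ≡⟨ cong ((g ⊕ idx g · l) ⊕_) (·-⊖ (idx g) l) ⟩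
      (g ⊕ idx g · l) - idx g · l             ≡⟨ //-rightDividesʳ _ g ⟩
      g                                       ∎
      where open ≡-Reasoning

    shear-aut : ∀ {l} → L l → AutGA lab (shear l)
    shear-aut {l} L-l = fixing-basic-sets (bij , shear-hom l) fixes
      where
      thin = proj₁ L-l
      bij = Bijections.bijective (shear l) (shear (⊖ l)) (shear-inverse thin)
              (λ g → subst (λ l' → shear l' (shear (⊖ l) g) ≡ g) (⁻¹-involutive l) (shear-inverse (⊖-thin thin) g))
      fixes : ∀ z → lab (shear l z) ≡ lab z
      fixes z with thin? z
      ... | yes thin-z = cong lab (trans (cong (λ k → z ⊕ k · l) (to (thin⇔idx≡0 z) thin-z))
                                         (identityʳ z))
      ... | no non-thin-z = proj₂ (from (stab-independent non-thin-z) (stab-· (idx z) L-l))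

    orbits : ∀ g h → (lab g ≡ lab h) ⇔ SameOrbit (AutGA lab) g h
    orbits g h = mk⇔ to-orbit (λ (σ , aut , σg≡h) → trans (sym (fixes-basic-sets aut g)) (cong lab σg≡h))
      where
      to-orbit : lab g ≡ lab h → SameOrbit (AutGA lab) g h
      to-orbit g~h with thin? g
      ... | yes thin = (λ x → x) , fixing-basic-sets autG-id (λ _ → refl) , sym (thin-singleton thin h (sym g~h))
      ... | no non-thin =
        let (m , m*k·≡id) = residue-inverse p-prime (idx g) (idx-pos non-thin) (idx<p g)
            l = m · (h - g)
        in shear l , shear-aut (stab-· m (class-is-coset g h (sym g~h))) , (begin
          g ⊕ idx g · (m · (h - g))     ≡⟨ cong (g ⊕_) (×-assocˡ (h - g) (idx g) m) ⟩
          g ⊕ (idx g * m) · (h - g)     ≡⟨ cong (λ k → g ⊕ k · (h - g)) (*-comm (idx g) m) ⟩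
          g ⊕ (m * idx g) · (h - g)     ≡⟨ cong (g ⊕_) (m*k·≡id (h - g)) ⟩
          g ⊕ (h - g)                   ≡⟨ add-diff h g ⟩
          h                             ∎)
        where open ≡-Reasoning

    cyclotomic : IsCyclotomic lab
    cyclotomic = AutGA lab , aut-subgroup , orbits

    -- any K ≤ Aut(G) with the orbits of Aut_G(A) fixes the basic sets, so
    -- K ⊆ Aut_G(A); and it contains, for each σ ∈ Aut_G(A), an element
    -- agreeing with σ at c, hence equal to σ
    cayley-minimal : IsCayleyMinimal lab
    cayley-minimal = cyclotomic , λ K K-subgroup same-orbits σ →
      mk⇔ (K⊆Aut K K-subgroup same-orbits σ) (Aut⊆K K K-subgroup same-orbits σ)
      where
      K⊆Aut : ∀ K → IsAutSubgroup K → (∀ g h → SameOrbit K g h ⇔ SameOrbit (AutGA lab) g h) →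
              ∀ σ → K σ → AutGA lab σ
      K⊆Aut K K-subgroup same-orbits σ K-σ = fixing-basic-sets (IsAutSubgroup.auts K-subgroup σ K-σ) λ z →
        let (τ , aut-τ , τz≡σz) = to (same-orbits z (σ z)) (σ , K-σ , refl)
        in trans (cong lab (sym τz≡σz)) (fixes-basic-sets aut-τ z)
      Aut⊆K : ∀ K → IsAutSubgroup K → (∀ g h → SameOrbit K g h ⇔ SameOrbit (AutGA lab) g h) →
              ∀ σ → AutGA lab σ → K σ
      Aut⊆K K K-subgroup same-orbits σ aut-σ =
        let (τ , K-τ , τc≡σc) = from (same-orbits c (σ c)) (σ , aut-σ , refl)
        in IsAutSubgroup.extensional K-subgroup τ σ K-τ
             (aut-determined (K⊆Aut K K-subgroup same-orbits τ K-τ) aut-σ τc≡σc)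

  open Cyclotomy public

  module CIProperty where

    -- Let f be an isomorphism from A onto an S-ring over G, and
    -- F = f - f(e).  F is additive on O_θ, and F(g + c) differs from
    -- F(g) + F(c) by F(l) for some l ∈ L.  Hence F(k·c) = k·F(c) + F(ℓ k) with
    -- ℓ k ∈ L, and σ = F ∘ untwist is an automorphism of G, where
    -- untwist g = g - ℓ(idx g); the twist g ↦ g + ℓ(idx g) followed by a
    -- translation lies in Aut(A), and f = σ ∘ (translated twist).
    module Isomorphism (lab' : G → ℕ) (f : G → G) (f-bij : Bijective _≡_ _≡_ f)
             (f-iso : ∀ g h g' h' → (lab (h - g) ≡ lab (h' - g')) ⇔ (lab' (f h - f g) ≡ lab' (f h' - f g')))
             where

      open ≡-Reasoning

      F : G → G
      F g = f g - f e

      F⁻¹ : G → G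
      F⁻¹ y = Bijections.inverse f f-bij (y ⊕ f e)

      F-F⁻¹ : ∀ y → F (F⁻¹ y) ≡ y
      F-F⁻¹ y = trans (cong (_- f e) (Bijections.inverse-right f f-bij (y ⊕ f e))) (//-rightDividesʳ (f e) y)

      F⁻¹-F : ∀ g → F⁻¹ (F g) ≡ g
      F⁻¹-F g = trans (cong (Bijections.inverse f f-bij) (//-rightDividesˡ (f e) (f g)))
                      (Bijections.inverse-left f f-bij g)

      F-reflects : ∀ v w → lab' (F v) ≡ lab' (F w) → lab v ≡ lab w
      F-reflects v w Fv~Fw = subst₂ (λ a b → lab a ≡ lab b) (diff-e v) (diff-e w) (from (f-iso e v e w) Fv~Fw)

      step-label : ∀ g d → lab' (f (g ⊕ d) - f g) ≡ lab' (F d)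
      step-label g d = to (f-iso g (g ⊕ d) e d) (cong lab (trans (xyx⁻¹≈y g d) (sym (diff-e d))))

      -- for t thin, F(t) forms a singleton A'-basic set, so f(g + t) - f(g) = F(t)
      F-step-thin : ∀ {t} → Thin t → ∀ g → f (g ⊕ t) - f g ≡ F t
      F-step-thin {t} thin g = begin
        y                   ≡⟨ F-F⁻¹ y ⟨
        F (F⁻¹ y)           ≡⟨ cong F (thin-singleton thin (F⁻¹ y) (F-reflects _ t (trans (cong lab' (F-F⁻¹ y)) (step-label g t)))) ⟩
        F t                 ∎
        where y = f (g ⊕ t) - f g

      F-add-thin : ∀ g {t} → Thin t → F (g ⊕ t) ≡ F g ⊕ F t
      F-add-thin g {t} thin = begin
        f (g ⊕ t) - f e                      ≡⟨ diff-chain (f (g ⊕ t)) (f g) (f e) ⟨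
        (f (g ⊕ t) - f g) ⊕ (f g - f e)      ≡⟨ cong (_⊕ F g) (F-step-thin thin g) ⟩
        F t ⊕ F g                            ≡⟨ comm (F t) (F g) ⟩
        F g ⊕ F t                            ∎

      F-⊖ : ∀ {l} → Thin l → F (⊖ l) ≡ ⊖ F l
      F-⊖ {l} thin = inverseʳ-unique (F l) (F (⊖ l))
        (trans (sym (F-add-thin l (⊖-thin thin))) (trans (cong F (inverseʳ l)) (inverseʳ (f e))))

      -- F(g + c) = F(g) + F(c) + F(l) with l ∈ L: the A'-basic set of
      -- f(g + c) - f(g) is that of F(c), which is the image of c + L
      F-step-c : ∀ g → ∃[ l ] (L l × F (g ⊕ c) ≡ (F g ⊕ F c) ⊕ F l)
      F-step-c g = l , L-l , (begin
        F (g ⊕ c)                 ≡⟨ add-diff (F (g ⊕ c)) (F g) ⟨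
        F g ⊕ y                   ≡⟨ cong (F g ⊕_) (F-F⁻¹ y) ⟨
        F g ⊕ F v                 ≡⟨ cong (λ w → F g ⊕ F w) (add-diff v c) ⟨
        F g ⊕ F (c ⊕ l)           ≡⟨ cong (F g ⊕_) (F-add-thin c (proj₁ L-l)) ⟩
        F g ⊕ (F c ⊕ F l)         ≡⟨ assoc (F g) (F c) (F l) ⟨
        (F g ⊕ F c) ⊕ F l         ∎)
        where
        y = F (g ⊕ c) - F g
        v = F⁻¹ y
        l = v - c
        y~Fc : lab' y ≡ lab' (F c)
        y~Fc = trans (cong lab' (diff-translate (f (g ⊕ c)) (f g) (⊖ f e))) (step-label g c)
        L-l : L l
        L-l = class-is-coset c v (F-reflects v c (trans (cong lab' (F-F⁻¹ y)) y~Fc))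

      F-multiple : ∀ k → ∃[ l ] (L l × F (k · c) ≡ k · F c ⊕ F l)
      F-multiple zero = e , stab-e c , sym (identityˡ (F e))
      F-multiple (suc k) =
        let (l₀ , L-l₀ , F-kc) = F-multiple k
            (l₁ , L-l₁ , F-kc+c) = F-step-c (k · c)
        in l₀ ⊕ l₁ , stab-⊕ L-l₀ L-l₁ , (begin
          F (c ⊕ k · c)                             ≡⟨ cong F (comm c (k · c)) ⟩
          F (k · c ⊕ c)                             ≡⟨ F-kc+c ⟩
          (F (k · c) ⊕ F c) ⊕ F l₁                  ≡⟨ cong (λ x → (x ⊕ F c) ⊕ F l₁) F-kc ⟩
          ((k · F c ⊕ F l₀) ⊕ F c) ⊕ F l₁           ≡⟨ cong (_⊕ F l₁) (xy∙z≈xz∙y (k · F c) (F l₀) (F c)) ⟩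
          ((k · F c ⊕ F c) ⊕ F l₀) ⊕ F l₁           ≡⟨ assoc _ (F l₀) (F l₁) ⟩
          (k · F c ⊕ F c) ⊕ (F l₀ ⊕ F l₁)           ≡⟨ cong₂ _⊕_ (comm (F c) (k · F c)) (F-add-thin l₀ (proj₁ L-l₁)) ⟨
          (F c ⊕ k · F c) ⊕ F (l₀ ⊕ l₁)             ∎)

      ℓ : ℕ → G
      ℓ k = proj₁ (F-multiple k)

      L-ℓ : ∀ k → L (ℓ k)
      L-ℓ k = proj₁ (proj₂ (F-multiple k))

      thin-ℓ : ∀ k → Thin (ℓ k)
      thin-ℓ k = proj₁ (L-ℓ k)

      twist untwist : G → G
      twist   g = g ⊕ ℓ (idx g)
      untwist g = g - ℓ (idx g)

      untwist-twist : ∀ g → untwist (twist g) ≡ g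
      untwist-twist g = trans (cong (λ k → twist g - ℓ k) (idx-translate g (thin-ℓ (idx g))))
                              (//-rightDividesʳ (ℓ (idx g)) g)

      twist-untwist : ∀ g → twist (untwist g) ≡ g
      twist-untwist g = trans (cong (λ k → untwist g ⊕ ℓ k) (idx-translate g (⊖-thin (thin-ℓ (idx g)))))
                              (//-rightDividesˡ (ℓ (idx g)) g)

      -- the automorphism of G agreeing with F on O_θ and sending c to F(c)
      σ : G → G
      σ g = F (g - idx g · c) ⊕ idx g · F c

      σ≡F∘untwist : ∀ g → σ g ≡ F (untwist g)
      σ≡F∘untwist g = sym (begin
        F (g - ℓ k)                              ≡⟨ cong (λ x → F (x - ℓ k)) (decompose g) ⟨
        F ((k · c ⊕ t) - ℓ k)                    ≡⟨ cong F (xy∙z≈xz∙y (k · c) t (⊖ ℓ k)) ⟩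
        F ((k · c - ℓ k) ⊕ t)                    ≡⟨ F-add-thin _ (idx-spec g) ⟩
        F (k · c - ℓ k) ⊕ F t                    ≡⟨ cong (_⊕ F t) (F-add-thin (k · c) (⊖-thin (thin-ℓ k))) ⟩
        (F (k · c) ⊕ F (⊖ ℓ k)) ⊕ F t            ≡⟨ cong₂ (λ x y → (x ⊕ y) ⊕ F t) (proj₂ (proj₂ (F-multiple k))) (F-⊖ (thin-ℓ k)) ⟩
        ((k · F c ⊕ F (ℓ k)) - F (ℓ k)) ⊕ F t    ≡⟨ cong (_⊕ F t) (//-rightDividesʳ (F (ℓ k)) (k · F c)) ⟩
        k · F c ⊕ F t                            ≡⟨ comm (k · F c) (F t) ⟩
        F t ⊕ k · F c                            ∎)
        where
        k = idx g
        t = g - idx g · c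

      σ-hom : IsHom σ
      σ-hom a b = begin
        F ((a ⊕ b) - idx (a ⊕ b) · c) ⊕ idx (a ⊕ b) · F c
          ≡⟨ cong₂ (λ x y → F ((a ⊕ b) - x) ⊕ y) (idx-· a b c) (idx-· a b (F c)) ⟩
        F ((a ⊕ b) - (idx a · c ⊕ idx b · c)) ⊕ (idx a · F c ⊕ idx b · F c)
          ≡⟨ cong (λ x → F x ⊕ (idx a · F c ⊕ idx b · F c)) (diff-⊕ a b (idx a · c) (idx b · c)) ⟩
        F ((a - idx a · c) ⊕ (b - idx b · c)) ⊕ (idx a · F c ⊕ idx b · F c)
          ≡⟨ cong (_⊕ (idx a · F c ⊕ idx b · F c)) (F-add-thin _ (idx-spec b)) ⟩
        (F (a - idx a · c) ⊕ F (b - idx b · c)) ⊕ (idx a · F c ⊕ idx b · F c)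
          ≡⟨ interchange _ _ _ _ ⟩
        σ a ⊕ σ b ∎

      σ-aut : IsAutG σ
      σ-aut = Bijections.bijective σ (λ y → twist (F⁻¹ y))
        (λ g → trans (cong (λ x → twist (F⁻¹ x)) (σ≡F∘untwist g))
                     (trans (cong twist (F⁻¹-F (untwist g))) (twist-untwist g)))
        (λ y → trans (σ≡F∘untwist _) (trans (cong F (untwist-twist (F⁻¹ y))) (F-F⁻¹ y))) ,
        σ-hom

      -- the translated twist a, an element of Aut(A): differences change by
      -- elements of L, which stabilise the non-thin basic sets
      u : G
      u = twist (F⁻¹ (f e))

      a : G → G
      a g = twist g ⊕ u

      a-aut : IsAutA lab a
      a-aut = Bijections.bijective a (λ y → untwist (y - u))
                (λ g → trans (cong untwist (//-rightDividesʳ u (twist g))) (untwist-twist g))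
                (λ y → trans (cong (_⊕ u) (twist-untwist (y - u))) (//-rightDividesˡ u y)) ,
              preserves
        where
        preserves : ∀ g h → lab (a h - a g) ≡ lab (h - g)
        preserves g h with thin? (h - g)
        ... | yes thin = cong lab (begin
              a h - a g                                   ≡⟨ diff-translate (twist h) (twist g) u ⟩
              (h ⊕ ℓ (idx h)) - (g ⊕ ℓ (idx g))           ≡⟨ cong (λ k → (h ⊕ ℓ k) - (g ⊕ ℓ (idx g))) (to (same-coset⇔ h g) thin) ⟩
              (h ⊕ ℓ (idx g)) - (g ⊕ ℓ (idx g))           ≡⟨ diff-translate h g (ℓ (idx g)) ⟩
              h - g                                       ∎)
        ... | no non-thin = begin
              lab (a h - a g)                                         ≡⟨ cong lab (diff-translate (twist h) (twist g) u) ⟩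
              lab ((h ⊕ ℓ (idx h)) - (g ⊕ ℓ (idx g)))                 ≡⟨ cong lab (diff-⊕ h (ℓ (idx h)) g (ℓ (idx g))) ⟩
              lab ((h - g) ⊕ (ℓ (idx h) - ℓ (idx g)))                 ≡⟨ cong lab (comm (h - g) _) ⟩
              lab ((ℓ (idx h) - ℓ (idx g)) ⊕ (h - g))                 ≡⟨ L-stabilises non-thin (stab-⊕ (L-ℓ (idx h)) (stab-⊖ (L-ℓ (idx g)))) ⟩
              lab (h - g)                                             ∎

      f≡σ∘a : ∀ g → f g ≡ σ (a g)
      f≡σ∘a g = sym (begin
        σ (twist g ⊕ u)                  ≡⟨ σ-hom (twist g) u ⟩
        σ (twist g) ⊕ σ u                ≡⟨ cong₂ _⊕_ (σ≡F∘untwist (twist g)) (σ≡F∘untwist u) ⟩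
        F (untwist (twist g)) ⊕ F (untwist u)  ≡⟨ cong₂ (λ x y → F x ⊕ F y) (untwist-twist g) (untwist-twist (F⁻¹ (f e))) ⟩
        F g ⊕ F (F⁻¹ (f e))              ≡⟨ cong (F g ⊕_) (F-F⁻¹ (f e)) ⟩
        F g ⊕ f e                        ≡⟨ //-rightDividesˡ (f e) (f g) ⟩
        f g                              ∎)

    is-CI : IsCI lab
    is-CI lab' _ f (f-bij , f-iso) = a , σ , a-aut , σ-aut , f≡σ∘a
      where open Isomorphism lab' f f-bij f-iso

  open CIProperty public

open Defs using (G; IsPSRing; count; thinᵇ; IsASubgroup; InOθ; IsWreath; _⊕_; ⊖_;
                 IsCyclotomic; IsCayleyMinimal; IsCI)

proposition4p3 : (p : ℕ) .{{_ : NonZero p}} → Prime p → (n : ℕ) → 1 ≤ n →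
    (lab : G p n → ℕ) → IsPSRing p n lab →
    count p n (thinᵇ p n lab) * p ≡ p ^ n →
    (∃[ L ] (IsASubgroup p n lab L
          × (∀ g → L g → InOθ p n lab g)
          × IsWreath p n lab (InOθ p n lab) L
          × (∀ x → InOθ p n lab x → ∀ y → lab y ≡ lab x → y ≡ x)
          × (∀ x y → lab x ≡ lab y → L (_⊕_ p n y (⊖_ p n x)))))
    × (IsCyclotomic p n lab × IsCayleyMinimal p n lab × IsCI p n lab)
proposition4p3 p p-prime n _ lab PS index-p =
  ( L
  , L-is-A-subgroup
  , (λ _ → proj₁)
  , L-wreath
  , (λ _ thin → thin-singleton thin)
  , (λ x y x~y → class-is-coset x y (sym x~y)) )
  , (cyclotomic , cayley-minimal , is-CI)
  where open IndexP p p-prime n lab PS index-p
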